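{- Let $n\ge2$ and equip $\mathcal{G}^z_{n-1}$ with its standard labeling. For $\omega\in\Omega(\mathcal{G}^z_{n-1})$ and $1\le i\le n-1$, let $\ell_i$ be the multiplicity in $\omega$ of the edge $f_{n-i}$, where $f_p$ denotes the right vertical edge of $T_p$ if $p$ is odd and the top horizontal edge of $T_p$ if $p$ is even. Let $\varphi(\omega)$ be the permutation of $S_n$ with Lehmer code $(\ell_1,\dots,\ell_{n-1},0)$. Then: (a) $\varphi$ is a poset isomorphism from $\Omega(\mathcal{G}^z_{n-1})$ with the face twist order onto the set $\mathrm{Cat}_n$ of $132$-avoiding permutations in $S_n$ with the (restriction of the) Bruhat order. (b) The rank generating function of the face twist order on $\Omega(\mathcal{G}^z_{n-1})$ equals $C_n(q):=\sum_{\sigma\in\mathrm{Cat}_n}q^{\mathrm{inv}(\sigma)}$.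
   Context: Mixed dimer covers: for a finite graph $\mathcal{G}=(V,E)$ and $\mathbf{n}\colon V\to\mathbb{N}$, a mixed dimer cover is $\omega\colon E\to\mathbb{N}$ with $\sum_{e\ni v}\omega(e)=\mathbf{n}(v)$ for all $v$. Zigzag snake graph $\mathcal{G}^z_N$: union of unit squares $T_1,\dots,T_N$ with $T_{2j+1}$ having lower-left corner $(j,j)$ and $T_{2j}$ having lower-left corner $(j-1,j)$; vertices are lattice points on the tiles, edges the unit sides. Standard labeling: for $1\le k\le N$, if $k=2j+1$ both vertices $(j,j),(j+1,j)$ get label $k$, if $k=2j$ both $(j-1,j),(j-1,j+1)$ get label $k$; the two remaining vertices get label $N+1$. $\Omega(\mathcal{G}^z_N)$ is the set of mixed dimer covers for this labeling. Face twist order: properly 2-color vertices black/white so that, if $N$ is odd, the bottom-right vertex of $T_N$ is black, and if $N$ is even, the top-right vertex of $T_N$ is black. Traversing a square face counterclockwise, edges traversed black-to-white are even and white-to-black odd; if all odd edges of a face have positive multiplicity, decreasing them by $1$ and increasing the even edges by $1$ is a positive face twist; the face twist order is generated by $\omega<\omega'$ when $\omega'$ is obtained from $\omega$ by a positive face twist. The rank generating function is $\sum_\omega q^{\mathrm{rk}(\omega)}$, $\mathrm{rk}(\omega)$ being the minimal number of face twists to reach $\omega$ from the minimal element. Lehmer code of $\sigma\in S_n$: $L_i=\#\{j>i:\sigma(j)<\sigma(i)\}$. $\sigma$ is $132$-avoiding if there are no $j<k<l$ with $\sigma(j)<\sigma(l)<\sigma(k)$. $\mathrm{inv}(\sigma)$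 is the number of inversions. -}

module Defs where

open import Data.Nat using (ℕ; zero; suc; _+_; _*_; _∸_; _≤_; _<_; _<ᵇ_; _≤ᵇ_; ⌊_/2⌋)
import Data.Nat as ℕ
open import Data.Bool using (Bool; true; false; not; if_then_else_; _∧_)
open import Data.Fin using (Fin; toℕ)
import Data.Fin as F
import Data.Fin.Properties as FP
open import Data.Fin.Permutation.Components using (transpose)
open import Data.Nat.ListAction using (sum)
open import Data.List using (List; []; _∷_; length; map; filterᵇ; cartesianProduct; allFin)
open import Data.Product using (Σ; ∃; _×_; _,_; proj₁; proj₂)
open import Relation.Nullary using (¬_; does)
open import Relation.Binary.PropositionalEquality using (_≡_; _≢_)
open import Function.Definitions using (Injective)

Point : Set
Point = ℕ × ℕ

data Edge : Set where
  h : ℕ → ℕ → Edge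
  v : ℕ → ℕ → Edge

ends : Edge → Point × Point
ends (h x y) = (x , y) , (suc x , y)
ends (v x y) = (x , y) , (x , suc y)

isOdd : ℕ → Bool
isOdd zero    = false
isOdd (suc n) = not (isOdd n)

-- lower-left corner of the tile T_k (k ≥ 1):
-- k = 2j+1 ↦ (j , j),  k = 2j ↦ (j-1 , j)
ll : ℕ → Point
ll k = if isOdd k then (⌊ k /2⌋ , ⌊ k /2⌋) else (⌊ k /2⌋ ∸ 1 , ⌊ k /2⌋)

data Side : Set where
  bottom right top left : Side

sideEdge : Point → Side → Edge
sideEdge (a , b) bottom = h a b
sideEdge (a , b) right  = v (suc a) b
sideEdge (a , b) top    = h a (suc b)
sideEdge (a , b) left   = v a b

-- the vertex at which the side starts when the square is traversed
-- counterclockwise: (a,b) → (a+1,b) → (a+1,b+1) → (a,b+1) → (a,b)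
sideStart : Point → Side → Point
sideStart (a , b) bottom = (a , b)
sideStart (a , b) right  = (suc a , b)
sideStart (a , b) top    = (suc a , suc b)
sideStart (a , b) left   = (a , suc b)

IsTile : ℕ → ℕ → Set
IsTile N k = (1 ≤ k) × (k ≤ N)

IsEdge : ℕ → Edge → Set
IsEdge N e = Σ ℕ λ k → IsTile N k × Σ Side λ s → sideEdge (ll k) s ≡ e

IsVertex : ℕ → Point → Set
IsVertex N p = Σ ℕ λ k → IsTile N k × Σ Side λ s → sideStart (ll k) s ≡ p

-- lattice edges incident to a point (an edge of G^z_N containing p is among them)
incident : Point → List Edge
incident (x , y) = h x y ∷ v x y ∷ hl x ++' vl y
  where
  hl : ℕ → List Edge
  hl zero    = []
  hl (suc a) = h a y ∷ []
  vl : ℕ → List Edge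
  vl zero    = []
  vl (suc b) = v x b ∷ []
  _++'_ : List Edge → List Edge → List Edge
  []       ++' ys = ys
  (z ∷ zs) ++' ys = z ∷ (zs ++' ys)

-- Standard labeling.
-- k = 2j+1 labels (j,j) and (j+1,j);  k = 2j labels (j-1,j) and (j-1,j+1);
-- every other vertex gets N+1.  labelCand returns the unique candidate k
-- for which p is one of the listed vertices of T_k (0 if there is none).

labelCand : Point → ℕ
labelCand (x , y) =
  if does (x ℕ.≟ y) then suc (2 * x)
  else if does (x ℕ.≟ suc y) then suc (2 * y)
  else if does (suc x ℕ.≟ y) then 2 * y
  else if does (suc (suc x) ℕ.≟ y) then 2 * suc x
  else 0

label : ℕ → Point → ℕ
label N p = if (1 ≤ᵇ labelCand p) ∧ (labelCand p ≤ᵇ N) then labelCand p else suc N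

-- Mixed dimer covers of (G^z_N , standard labeling).
-- A cover ω : E → ℕ is represented by a multiplicity function on all
-- lattice edges vanishing outside E.

record Cover (N : ℕ) : Set where
  field
    mult     : Edge → ℕ
    support  : ∀ e → ¬ IsEdge N e → mult e ≡ 0
    balanced : ∀ p → IsVertex N p → sum (map mult (incident p)) ≡ label N p
open Cover public

_≈ᶜ_ : ∀ {N} → Cover N → Cover N → Set
ω ≈ᶜ ω' = ∀ e → mult ω e ≡ mult ω' e

ProperColouring : ℕ → (Point → Bool) → Set
ProperColouring N c = ∀ e → IsEdge N e → c (proj₁ (ends e)) ≢ c (proj₂ (ends e))

Normalised : ℕ → (Point → Bool) → Set
Normalised N c = if isOdd N then c (sideStart (ll N) right) ≡ true
                            else c (sideStart (ll N) top) ≡ true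

-- side s of face T_k is even (traversed black → white) / odd (white → black)
EvenSide OddSide : (Point → Bool) → ℕ → Side → Set
EvenSide c k s = c (sideStart (ll k) s) ≡ true
OddSide  c k s = c (sideStart (ll k) s) ≡ false

record PosTwist (N : ℕ) (c : Point → Bool) (ω ω' : Edge → ℕ) : Set where
  field
    face     : ℕ
    isFace   : IsTile N face
    positive : ∀ s → OddSide c face s → 1 ≤ ω (sideEdge (ll face) s)
    onOdd    : ∀ s → OddSide c face s →
               ω' (sideEdge (ll face) s) ≡ ω (sideEdge (ll face) s) ∸ 1
    onEven   : ∀ s → EvenSide c face s →
               ω' (sideEdge (ll face) s) ≡ suc (ω (sideEdge (ll face) s))
    offFace  : ∀ e → (∀ s → sideEdge (ll face) s ≢ e) → ω' e ≡ ω e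

data TwistChain (N : ℕ) (c : Point → Bool) : Cover N → Cover N → ℕ → Set where
  done : ∀ {ω ω'} → ω ≈ᶜ ω' → TwistChain N c ω ω' 0
  step : ∀ {ω ρ ω' r} → TwistChain N c ω ρ r → PosTwist N c (mult ρ) (mult ω') →
         TwistChain N c ω ω' (suc r)

_≤F⟨_⟩_ : ∀ {N} → Cover N → (Point → Bool) → Cover N → Set
_≤F⟨_⟩_ {N} ω c ω' = Σ ℕ λ r → TwistChain N c ω ω' r

Rank : (N : ℕ) → (Point → Bool) → Cover N → ℕ → Set
Rank N c ω r = Σ (Cover N) λ ω₀ →
  (∀ ω' → ω₀ ≤F⟨ c ⟩ ω') ×
  TwistChain N c ω₀ ω r ×
  (∀ r' → TwistChain N c ω₀ ω r' → r ≤ r')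

record Perm (n : ℕ) : Set where
  field
    fun : Fin n → Fin n
    inj : Injective _≡_ _≡_ fun
open Perm public

_≈ₚ_ : ∀ {n} → Perm n → Perm n → Set
σ ≈ₚ τ = ∀ i → fun σ i ≡ fun τ i

lehmer : ∀ {n} → Perm n → Fin n → ℕ
lehmer {n} σ i = length (filterᵇ (λ j → does (i FP.<? j) ∧ does (fun σ j FP.<? fun σ i)) (allFin n))

inv : ∀ {n} → Perm n → ℕ
inv {n} σ = length (filterᵇ (λ p → does (proj₁ p FP.<? proj₂ p) ∧ does (fun σ (proj₂ p) FP.<? fun σ (proj₁ p)))
                            (cartesianProduct (allFin n) (allFin n)))

Avoids132 : ∀ {n} → Perm n → Set
Avoids132 {n} σ = ¬ (Σ (Fin n) λ j → Σ (Fin n) λ k → Σ (Fin n) λ l →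
  (j F.< k) × (k F.< l) × (fun σ j F.< fun σ l) × (fun σ l F.< fun σ k))

BruhatStep : ∀ {n} → Perm n → Perm n → Set
BruhatStep {n} σ τ = Σ (Fin n) λ i → Σ (Fin n) λ j →
  (i F.< j) × (fun σ i F.< fun σ j) × (∀ k → fun τ k ≡ fun σ (transpose i j k))

data _≤B_ {n : ℕ} : Perm n → Perm n → Set where
  refl≈ : ∀ {σ τ} → σ ≈ₚ τ → σ ≤B τ
  step  : ∀ {σ ρ τ} → σ ≤B ρ → BruhatStep ρ τ → σ ≤B τ

fEdge : ℕ → Edge
fEdge p = if isOdd p then sideEdge (ll p) right else sideEdge (ll p) top

-- the sequence (ℓ_1 , … , ℓ_{n-1} , 0), ℓ_i = ω(f_{n-i}); position i : Fin n is i+1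
codeOf : (n : ℕ) → Cover (n ∸ 1) → Fin n → ℕ
codeOf n ω i = if suc (toℕ i) <ᵇ n then mult ω (fEdge (n ∸ suc (toℕ i))) else 0

HasCount : (A : Set) → (A → A → Set) → (A → Set) → ℕ → Set
HasCount A _≈_ P m = Σ (Fin m → A) λ f →
  (∀ i → P (f i)) × (∀ i j → f i ≈ f j → i ≡ j) × (∀ a → P a → Σ (Fin m) λ i → f i ≈ a)

{-# OPTIONS --safe #-}
module Submission where

-- A mixed dimer cover ω of the zigzag snake is determined by its heights a_k = ω(f_k): the
-- balance conditions at the two vertices labelled k force ω(g_k) = k - a_k on the other edge
-- at the outer corner of T_k, and ω(x_k) = a_k - a_(k-1) on the edge x_k shared by T_(k-1) and
-- T_k.  So covers correspond to sequences 0 = a_0 ≤ a_1 ≤ … ≤ a_N with a_k ≤ k, and read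
-- backwards these are exactly the weakly decreasing Lehmer codes, i.e. the codes of the
-- 132-avoiding permutations.  Under the prescribed colouring f_k and x_k are the even sides of
-- T_k, so a positive twist at T_k raises a_k by one and changes no other height: the twist
-- order is the componentwise order of codes and the rank of a cover is its code sum, the
-- number of inversions of its permutation.  On 132-avoiding permutations the Bruhat order is
-- componentwise order of codes too: raising one code entry is a Bruhat step (swap σ(i) with
-- the next larger value to its right), and conversely Bruhat steps only shrink the counts
-- #{a < x | σ(a) < k}, which for a weakly decreasing code bound each code entry from below.

open import Level using (0ℓ)
open import Data.Bool using (Bool; true; false; not; if_then_else_; T)
open import Data.Bool.Properties using (¬-not; T-≡; T-∧)
open import Data.Empty using (⊥; ⊥-elim)
open import Data.Fin using (Fin; zero; suc; toℕ; fromℕ<; punchIn; punchOut) renaming (_<_ to _<ᶠ_)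
import Data.Fin.Properties as Fin
open import Data.Fin.Permutation.Components using (transpose; transpose-inverse)
open import Data.List using (List; []; _∷_; length; filterᵇ; tabulate; allFin; map; _++_; concatMap; cartesianProduct)
import Data.List.Properties as List
open import Data.List.Membership.Propositional using (_∈_)
open import Data.List.Membership.Propositional.Properties using (∈-map⁺; ∈-concatMap⁺; ∈-allFin)
open import Data.List.Relation.Unary.Any using (here; there)
import Data.List.Relation.Unary.Any as Any
open import Data.Maybe using (Maybe; just; nothing; maybe)
import Data.Maybe as Maybe
open import Data.Maybe.Properties using (just-injective)
open import Data.Nat
open import Data.Nat.Properties
open import Algebra.Properties.CommutativeMonoid.Sum +-0-commutativeMonoid
  using (sum; sum-cong-≗; sum-remove; sum-replicate-zero)
open import Algebra.Properties.CommutativeSemigroup +-commutativeSemigroup using (x∙yz≈y∙xz)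
import Data.Nat.ListAction as ListAction
open import Data.Nat.Tactic.RingSolver using (solve-∀)
open import Data.Product using (Σ; ∃; _×_; _,_; proj₁; proj₂)
open import Data.Sum using (_⊎_; inj₁; inj₂)
open import Data.Unit using (tt)
open import Data.Vec.Functional using (updateAt)
open import Data.Vec.Functional.Properties using (updateAt-updates; updateAt-minimal)
open import Function using (_∘_; case_of_)
open import Function.Bundles using (_⇔_; mk⇔; Equivalence)
open import Relation.Binary using (Rel; IsEquivalence; tri<; tri≈; tri>)
import Relation.Binary.Definitions as B
open import Relation.Binary.PropositionalEquality
open import Relation.Nullary using (¬_; Dec; yes; no; does; contradiction)
open import Relation.Nullary.Decidable using (_×-dec_; _→-dec_; dec-true; dec-false; T?)
open import Relation.Unary using (Pred; Decidable; _⊆_)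
open import Defs

-- Permutations

module _ {n} (σ : Perm (suc n)) where

  private
    head≢ : ∀ j → fun σ zero ≢ fun σ (suc j)
    head≢ j eq = Fin.0≢1+n (inj σ eq)

  removeHead : Perm n
  removeHead = record
    { fun = λ j → punchOut (head≢ j)
    ; inj = λ {i} {j} eq → Fin.suc-injective (inj σ (Fin.punchOut-injective (head≢ i) (head≢ j) eq))
    }

  punchIn-removeHead : ∀ j → punchIn (fun σ zero) (fun removeHead j) ≡ fun σ (suc j)
  punchIn-removeHead j = Fin.punchIn-punchOut (head≢ j)

insertHead : ∀ {n} → Fin (suc n) → Perm n → Perm (suc n)
insertHead {n} s π = record { fun = f ; inj = f-injective }
  where
  f : Fin (suc n) → Fin (suc n)
  f zero    = s
  f (suc j) = punchIn s (fun π j)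
  f-injective : ∀ {i j} → f i ≡ f j → i ≡ j
  f-injective {zero}  {zero}  _  = refl
  f-injective {zero}  {suc j} eq = contradiction (sym eq) (Fin.punchInᵢ≢i s (fun π j))
  f-injective {suc i} {zero}  eq = contradiction eq (Fin.punchInᵢ≢i s (fun π i))
  f-injective {suc i} {suc j} eq = cong suc (inj π (Fin.punchIn-injective s _ _ eq))

removeHead-insertHead : ∀ {n} (s : Fin (suc n)) (π : Perm n) → removeHead (insertHead s π) ≈ₚ π
removeHead-insertHead s π j = trans (Fin.punchOut-cong s refl) (Fin.punchOut-punchIn s)

transpose-i : ∀ {n} (i j : Fin n) → transpose i j i ≡ j
transpose-i i j rewrite dec-true (i Fin.≟ i) refl = refl

transpose-j : ∀ {n} (i j : Fin n) → transpose i j j ≡ i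
transpose-j i j with j Fin.≟ i
... | yes j≡i = j≡i
... | no  j≢i rewrite dec-true (j Fin.≟ j) refl = refl

transpose-other : ∀ {n} (i j k : Fin n) → k ≢ i → k ≢ j → transpose i j k ≡ k
transpose-other i j k k≢i k≢j rewrite dec-false (k Fin.≟ i) k≢i | dec-false (k Fin.≟ j) k≢j = refl

data TransposeView {n} (i j : Fin n) : Fin n → Set where
  at-i  : TransposeView i j i
  at-j  : TransposeView i j j
  other : ∀ {k} → k ≢ i → k ≢ j → TransposeView i j k

transposeView : ∀ {n} (i j k : Fin n) → TransposeView i j k
transposeView i j k with k Fin.≟ i | k Fin.≟ j
... | yes refl | _        = at-i
... | no _     | yes refl = at-j
... | no k≢i   | no k≢j   = other k≢i k≢j

transposition : ∀ {n} → Fin n → Fin n → Perm n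
transposition i j = record
  { fun = transpose i j
  ; inj = λ eq → trans (sym (transpose-inverse j i)) (trans (cong (transpose j i) eq) (transpose-inverse j i))
  }

swap : ∀ {n} → Perm n → Fin n → Fin n → Perm n
swap σ i j = record { fun = fun σ ∘ transpose i j ; inj = inj (transposition i j) ∘ inj σ }

-- Counting and sums over Fin n

indicator : {A : Set} → Dec A → ℕ
indicator a? = if does a? then 1 else 0

indicator-yes : {A : Set} (a? : Dec A) → A → indicator a? ≡ 1
indicator-yes a? a = cong (if_then 1 else 0) (dec-true a? a)

indicator-no : {A : Set} (a? : Dec A) → ¬ A → indicator a? ≡ 0
indicator-no a? ¬a = cong (if_then 1 else 0) (dec-false a? ¬a)

count : ∀ {n} {P : Pred (Fin n) 0ℓ} → Decidable P → ℕ
count P? = sum (indicator ∘ P?)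

count-mono : ∀ {n} {P Q : Pred (Fin n) 0ℓ} (P? : Decidable P) (Q? : Decidable Q) → P ⊆ Q → count P? ≤ count Q?
count-mono {zero}  _  _  _   = z≤n
count-mono {suc n} P? Q? P⊆Q with P? zero | Q? zero
... | yes p | no ¬q = contradiction (P⊆Q p) ¬q
... | yes _ | yes _ = s≤s (count-mono (P? ∘ suc) (Q? ∘ suc) P⊆Q)
... | no _  | yes _ = m≤n⇒m≤1+n (count-mono (P? ∘ suc) (Q? ∘ suc) P⊆Q)
... | no _  | no _  = count-mono (P? ∘ suc) (Q? ∘ suc) P⊆Q

count-cong : ∀ {n} {P Q : Pred (Fin n) 0ℓ} (P? : Decidable P) (Q? : Decidable Q) → P ⊆ Q → Q ⊆ P →
             count P? ≡ count Q?
count-cong P? Q? P⊆Q Q⊆P = ≤-antisym (count-mono P? Q? P⊆Q) (count-mono Q? P? Q⊆P)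

count-none : ∀ {n} {P : Pred (Fin n) 0ℓ} (P? : Decidable P) → (∀ j → ¬ P j) → count P? ≡ 0
count-none {zero}  P? ¬P = refl
count-none {suc n} P? ¬P with P? zero
... | yes p = contradiction p (¬P zero)
... | no _  = count-none (P? ∘ suc) (¬P ∘ suc)

count-all : ∀ {n} {P : Pred (Fin n) 0ℓ} (P? : Decidable P) → (∀ j → P j) → count P? ≡ n
count-all {zero}  P? allP = refl
count-all {suc n} P? allP with P? zero
... | yes _ = cong suc (count-all (P? ∘ suc) (allP ∘ suc))
... | no ¬p = contradiction (allP zero) ¬p

count≡0⇒none : ∀ {n} {P : Pred (Fin n) 0ℓ} (P? : Decidable P) → count P? ≡ 0 → ∀ j → ¬ P j
count≡0⇒none {suc n} P? count≡0 j pj with P? zero | j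
... | yes _  | _     = case count≡0 of λ ()
... | no ¬p0 | zero  = ¬p0 pj
... | no _   | suc j = count≡0⇒none (P? ∘ suc) count≡0 j pj

count-witness : ∀ {n} {P Q : Pred (Fin n) 0ℓ} (P? : Decidable P) (Q? : Decidable Q) →
                count Q? < count P? → ∃ λ j → P j × ¬ Q j
count-witness {suc n} P? Q? lt with P? zero | Q? zero
... | yes p | no ¬q = zero , p , ¬q
... | yes _ | yes _ = let j , pj , ¬qj = count-witness (P? ∘ suc) (Q? ∘ suc) (s<s⁻¹ lt) in suc j , pj , ¬qj
... | no _  | no _  = let j , pj , ¬qj = count-witness (P? ∘ suc) (Q? ∘ suc) lt in suc j , pj , ¬qj
... | no _  | yes _ = let j , pj , ¬qj = count-witness (P? ∘ suc) (Q? ∘ suc) (<-trans (n<1+n _) lt) in suc j , pj , ¬qj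

count-punchIn : ∀ {n} {P : Pred (Fin (suc n)) 0ℓ} (P? : Decidable P) (s : Fin (suc n)) →
                count P? ≡ indicator (P? s) + count (P? ∘ punchIn s)
count-punchIn P? s = sum-remove (indicator ∘ P?)

count-strict : ∀ {n} {P Q : Pred (Fin n) 0ℓ} (P? : Decidable P) (Q? : Decidable Q) → P ⊆ Q →
               ∀ x → Q x → ¬ P x → count P? < count Q?
count-strict {suc n} P? Q? P⊆Q x qx ¬px = begin-strict
  count P?                                    ≡⟨ count-punchIn P? x ⟩
  indicator (P? x) + count (P? ∘ punchIn x)   ≡⟨ cong (_+ count (P? ∘ punchIn x)) (indicator-no (P? x) ¬px) ⟩
  count (P? ∘ punchIn x)                      <⟨ s≤s (count-mono (P? ∘ punchIn x) (Q? ∘ punchIn x) P⊆Q) ⟩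
  1 + count (Q? ∘ punchIn x)                  ≡⟨ cong (_+ count (Q? ∘ punchIn x)) (indicator-yes (Q? x) qx) ⟨
  indicator (Q? x) + count (Q? ∘ punchIn x)   ≡⟨ count-punchIn Q? x ⟨
  count Q?                                    ∎
  where open ≤-Reasoning

count-suc : ∀ {n} {P Q : Pred (Fin n) 0ℓ} (P? : Decidable P) (Q? : Decidable Q) (y : Fin n) →
            (∀ {j} → j ≢ y → P j → Q j) → (∀ {j} → j ≢ y → Q j → P j) → P y → ¬ Q y →
            count P? ≡ suc (count Q?)
count-suc {suc n} P? Q? y P⇒Q Q⇒P py ¬qy = begin
  count P?                                        ≡⟨ count-punchIn P? y ⟩
  indicator (P? y) + count (P? ∘ punchIn y)       ≡⟨ cong₂ _+_ (indicator-yes (P? y) py) away-from-y ⟩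
  suc (0 + count (Q? ∘ punchIn y))                ≡⟨ cong (λ k → suc (k + count (Q? ∘ punchIn y)))
                                                          (indicator-no (Q? y) ¬qy) ⟨
  suc (indicator (Q? y) + count (Q? ∘ punchIn y)) ≡⟨ cong suc (count-punchIn Q? y) ⟨
  suc (count Q?)                                  ∎
  where
  open ≡-Reasoning
  away-from-y : count (P? ∘ punchIn y) ≡ count (Q? ∘ punchIn y)
  away-from-y = count-cong (P? ∘ punchIn y) (Q? ∘ punchIn y)
                  (λ {j} → P⇒Q (Fin.punchInᵢ≢i y j)) (λ {j} → Q⇒P (Fin.punchInᵢ≢i y j))

count-permute : ∀ {n} {P : Pred (Fin n) 0ℓ} (P? : Decidable P) (σ : Perm n) → count (P? ∘ fun σ) ≡ count P?
count-permute {zero}  P? σ = refl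
count-permute {suc n} {P} P? σ = begin
  indicator (P? σ₀) + count (P? ∘ fun σ ∘ suc)
    ≡⟨ cong (indicator (P? σ₀) +_) (count-cong (P? ∘ fun σ ∘ suc) (P? ∘ punchIn σ₀ ∘ fun (removeHead σ))
         (λ {j} → subst P (sym (punchIn-removeHead σ j))) (λ {j} → subst P (punchIn-removeHead σ j))) ⟩
  indicator (P? σ₀) + count (P? ∘ punchIn σ₀ ∘ fun (removeHead σ))
    ≡⟨ cong (indicator (P? σ₀) +_) (count-permute (P? ∘ punchIn σ₀) (removeHead σ)) ⟩
  indicator (P? σ₀) + count (P? ∘ punchIn σ₀)
    ≡⟨ count-punchIn P? σ₀ ⟨
  count P? ∎
  where
  open ≡-Reasoning
  σ₀ : Fin (suc n)
  σ₀ = fun σ zero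

count-below : ∀ {n} m → m ≤ n → count (λ (j : Fin n) → toℕ j <? m) ≡ m
count-below {zero}  zero    _         = refl
count-below {suc n} zero    _         = count-none (λ (j : Fin (suc n)) → toℕ j <? 0) (λ _ ())
count-below {suc n} (suc m) (s≤s m≤n) =
  cong suc (trans (count-cong (λ (j : Fin n) → suc (toℕ j) <? suc m) (λ j → toℕ j <? m) s<s⁻¹ s<s)
                  (count-below m m≤n))

count-above : ∀ {n} m → count (λ (j : Fin n) → m <? toℕ j) ≡ n ∸ suc m
count-above {zero}  m       = refl
count-above {suc n} zero    = count-all (λ (j : Fin n) → 0 <? suc (toℕ j)) (λ _ → z<s)
count-above {suc n} (suc m) =
  trans (count-cong (λ (j : Fin n) → suc m <? suc (toℕ j)) (λ j → m <? toℕ j) s<s⁻¹ s<s) (count-above {n} m)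

length-filterᵇ-tabulate : ∀ {n} {A : Set} {P : Pred A 0ℓ} (P? : Decidable P) (f : Fin n → A) →
                          length (filterᵇ (does ∘ P?) (tabulate f)) ≡ count (P? ∘ f)
length-filterᵇ-tabulate {zero}  P? f = refl
length-filterᵇ-tabulate {suc n} P? f with does (P? (f zero))
... | true  = cong suc (length-filterᵇ-tabulate P? (f ∘ suc))
... | false = length-filterᵇ-tabulate P? (f ∘ suc)

length-filterᵇ-map : ∀ {A B : Set} (p : B → Bool) (g : A → B) (xs : List A) →
                     length (filterᵇ p (map g xs)) ≡ length (filterᵇ (p ∘ g) xs)
length-filterᵇ-map p g []       = refl
length-filterᵇ-map p g (x ∷ xs) with p (g x)
... | true  = cong suc (length-filterᵇ-map p g xs)
... | false = length-filterᵇ-map p g xs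

length-filterᵇ-cartesianProduct : ∀ {n} {A B : Set} (p : A × B → Bool) (f : Fin n → A) (ys : List B) →
  length (filterᵇ p (cartesianProduct (tabulate f) ys)) ≡ sum (λ i → length (filterᵇ (λ y → p (f i , y)) ys))
length-filterᵇ-cartesianProduct {zero}  p f ys = refl
length-filterᵇ-cartesianProduct {suc n} {A} {B} p f ys = begin
  length (filterᵇ p (map (f zero ,_) ys ++ rest))
    ≡⟨ cong length (List.filter-++ (T? ∘ p) (map (f zero ,_) ys) rest) ⟩
  length (filterᵇ p (map (f zero ,_) ys) ++ filterᵇ p rest)
    ≡⟨ List.length-++ (filterᵇ p (map (f zero ,_) ys)) ⟩
  length (filterᵇ p (map (f zero ,_) ys)) + length (filterᵇ p rest)
    ≡⟨ cong₂ _+_ (length-filterᵇ-map p (f zero ,_) ys) (length-filterᵇ-cartesianProduct p (f ∘ suc) ys) ⟩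
  sum (λ i → length (filterᵇ (λ y → p (f i , y)) ys)) ∎
  where
  open ≡-Reasoning
  rest : List (A × B)
  rest = cartesianProduct (tabulate (f ∘ suc)) ys

argmin : ∀ {n} {P : Pred (Fin n) 0ℓ} → Decidable P → (f : Fin n → ℕ) → ∃ P →
         ∃ λ j → P j × ∀ k → P k → f j ≤ f k
argmin {P = P} P? f (j , pj) = descend (f j) j ≤-refl pj
  where
  descend : ∀ b j → f j ≤ b → P j → ∃ λ j → P j × ∀ k → P k → f j ≤ f k
  descend zero    j fj≤0 pj = j , pj , λ _ _ → ≤-trans fj≤0 z≤n
  descend (suc b) j fj≤b pj with Fin.any? (λ k → P? k ×-dec f k <? f j)
  ... | yes (k , pk , fk<fj) = descend b k (s≤s⁻¹ (<-≤-trans fk<fj fj≤b)) pk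
  ... | no ∄k                = j , pj , λ k pk → ≮⇒≥ (λ fk<fj → ∄k (k , pk , fk<fj))

sum≡0 : ∀ {n} (f : Fin n → ℕ) → sum f ≡ 0 → ∀ j → f j ≡ 0
sum≡0 f eq zero    = m+n≡0⇒m≡0 (f zero) eq
sum≡0 f eq (suc j) = sum≡0 (f ∘ suc) (m+n≡0⇒n≡0 (f zero) eq) j

sum>0 : ∀ {n} (f : Fin n → ℕ) → 0 < sum f → ∃ λ j → 0 < f j
sum>0 {suc n} f pos with f zero in eq
... | suc _ = zero , subst (0 <_) (sym eq) z<s
... | zero  = let j , fj>0 = sum>0 (f ∘ suc) pos in suc j , fj>0

UnitStep : ∀ {n} → (Fin n → ℕ) → (Fin n → ℕ) → Fin n → Set
UnitStep c c′ i = c′ i ≡ suc (c i) × (∀ j → j ≢ i → c′ j ≡ c j)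

unitStep-cong : ∀ {n} {c d c′ d′ : Fin n → ℕ} {i} → (∀ j → c j ≡ d j) → (∀ j → c′ j ≡ d′ j) →
                UnitStep c c′ i → UnitStep d d′ i
unitStep-cong {i = i} c≗d c′≗d′ (c′i≡1+ci , same) =
  trans (sym (c′≗d′ i)) (trans c′i≡1+ci (cong suc (c≗d i))) ,
  λ j j≢i → trans (sym (c′≗d′ j)) (trans (same j j≢i) (c≗d j))

unitStep-unique : ∀ {n} {c c′ c″ : Fin n → ℕ} {i} → UnitStep c c′ i → UnitStep c c″ i →
                  ∀ j → c′ j ≡ c″ j
unitStep-unique {i = i} (c′i , c′j) (c″i , c″j) j with j Fin.≟ i
... | yes refl = trans c′i (sym c″i)
... | no j≢i   = trans (c′j j j≢i) (sym (c″j j j≢i))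

unitStep-≤ : ∀ {n} {c c′ : Fin n → ℕ} {i} → UnitStep c c′ i → ∀ j → c j ≤ c′ j
unitStep-≤ {i = i} (c′i , c′j) j with j Fin.≟ i
... | yes refl = ≤-trans (n≤1+n _) (≤-reflexive (sym c′i))
... | no j≢i   = ≤-reflexive (sym (c′j j j≢i))

unitStep-< : ∀ {n} {c c′ : Fin n → ℕ} {i} → UnitStep c c′ i → c i < c′ i
unitStep-< (c′i , _) = ≤-reflexive (sym c′i)

unitStep-pred : ∀ {n} (c : Fin n → ℕ) i → 0 < c i → UnitStep (updateAt c i pred) c i
unitStep-pred c i ci>0 = trans (sym (suc-pred (c i) ⦃ >-nonZero ci>0 ⦄)) (cong suc (sym (updateAt-updates i c))) ,
                         λ j j≢i → sym (updateAt-minimal j i c j≢i)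

unitStep-above : ∀ {n} {b c c′ : Fin n → ℕ} {i} → UnitStep c c′ i → (∀ j → b j ≤ c′ j) → b i < c′ i →
                 ∀ j → b j ≤ c j
unitStep-above {b = b} {i = i} (c′i , c′j) b≤c′ bi<c′i j with j Fin.≟ i
... | yes refl = s≤s⁻¹ (subst (b j <_) c′i bi<c′i)
... | no j≢i   = subst (b j ≤_) (c′j j j≢i) (b≤c′ j)

unitStep-∸ : ∀ {n} {b c c′ : Fin n → ℕ} {i} → UnitStep c c′ i → (∀ j → b j ≤ c j) →
             UnitStep (λ j → c j ∸ b j) (λ j → c′ j ∸ b j) i
unitStep-∸ {b = b} {i = i} (c′i , c′j) b≤c = trans (cong (_∸ b i) c′i) (+-∸-assoc 1 (b≤c i)) ,
                                            λ j j≢i → cong (_∸ b j) (c′j j j≢i)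

sum-unitStep : ∀ {n} {c c′ : Fin n → ℕ} {i} → UnitStep c c′ i → sum c′ ≡ suc (sum c)
sum-unitStep {suc n} {c} {c′} {i} (c′i≡1+ci , c′≗c) = begin
  sum c′                              ≡⟨ sum-remove c′ ⟩
  c′ i + sum (c′ ∘ punchIn i)         ≡⟨ cong₂ _+_ c′i≡1+ci
                                           (sum-cong-≗ (λ j → c′≗c _ (Fin.punchInᵢ≢i i j))) ⟩
  suc (c i + sum (c ∘ punchIn i))     ≡⟨ cong suc (sum-remove c) ⟨
  suc (sum c)                         ∎
  where open ≡-Reasoning

module Descent {n} {X : Set} (key : X → Fin n → ℕ) (Chain : X → X → ℕ → Set) (Step : X → X → Set)
  (done : ∀ {x y} → (∀ i → key x i ≡ key y i) → Chain x y 0)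
  (extend : ∀ {x y z r} → Chain x y r → Step y z → Chain x z (suc r))
  (lower : ∀ x y → (∀ i → key x i ≤ key y i) → (∃ λ i → key x i < key y i) →
           Σ X λ y′ → Σ (Fin n) λ i → key x i < key y i × UnitStep (key y′) (key y) i × Step y′ y)
  where

  descent : ∀ x y → (∀ i → key x i ≤ key y i) → Chain x y (sum (λ i → key y i ∸ key x i))
  descent x y x≤y = go _ y x≤y refl
    where
    go : ∀ D y → (∀ i → key x i ≤ key y i) → sum (λ i → key y i ∸ key x i) ≡ D → Chain x y D
    go zero    y x≤y gaps≡0 = done (λ i → ≤-antisym (x≤y i) (m∸n≡0⇒m≤n (sum≡0 _ gaps≡0 i)))
    go (suc D) y x≤y gaps≡1+D with lower x y x≤y (let i , gap>0 = sum>0 _ (subst (0 <_) (sym gaps≡1+D) z<s)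
                                                  in i , m∸n≢0⇒n<m (>⇒≢ gap>0))
    ... | y′ , i , xi<yi , unit , y′→y = extend (go D y′ x≤y′ (suc-injective gaps≡1+D′)) y′→y
      where
      x≤y′ : ∀ j → key x j ≤ key y′ j
      x≤y′ = unitStep-above unit x≤y xi<yi
      gaps≡1+D′ : suc (sum (λ j → key y′ j ∸ key x j)) ≡ suc D
      gaps≡1+D′ = trans (sym (sum-unitStep (unitStep-∸ unit x≤y′))) gaps≡1+D

-- Lehmer codes

Inversion : ∀ {n} → Perm n → Fin n → Fin n → Set
Inversion σ i j = i <ᶠ j × fun σ j <ᶠ fun σ i

inversion? : ∀ {n} (σ : Perm n) i → Decidable (Inversion σ i)
inversion? σ i j = (i Fin.<? j) ×-dec (fun σ j Fin.<? fun σ i)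

code : ∀ {n} → Perm n → Fin n → ℕ
code σ i = count (inversion? σ i)

lehmer≡code : ∀ {n} (σ : Perm n) i → lehmer σ i ≡ code σ i
lehmer≡code σ i = length-filterᵇ-tabulate (inversion? σ i) (λ j → j)

code-cong : ∀ {n} (σ τ : Perm n) → σ ≈ₚ τ → ∀ i → code σ i ≡ code τ i
code-cong σ τ σ≈τ i = count-cong (inversion? σ i) (inversion? τ i)
  (λ {j} (i<j , σj<σi) → i<j , subst₂ _<ᶠ_ (σ≈τ j) (σ≈τ i) σj<σi)
  (λ {j} (i<j , τj<τi) → i<j , subst₂ _<ᶠ_ (sym (σ≈τ j)) (sym (σ≈τ i)) τj<τi)

punchIn-mono-< : ∀ {n} s (x y : Fin n) → x <ᶠ y → punchIn s x <ᶠ punchIn s y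
punchIn-mono-< s x y x<y = ≰⇒> (λ py≤px → <⇒≱ x<y (Fin.punchIn-cancel-≤ s y x py≤px))

punchIn-cancel-< : ∀ {n} s (x y : Fin n) → punchIn s x <ᶠ punchIn s y → x <ᶠ y
punchIn-cancel-< s x y px<py = ≰⇒> (λ y≤x → <⇒≱ px<py (Fin.punchIn-mono-≤ s y x y≤x))

punchIn<pivot : ∀ {n} (s : Fin (suc n)) (x : Fin n) → toℕ x < toℕ s → punchIn s x <ᶠ s
punchIn<pivot (suc s) zero    _         = z<s
punchIn<pivot (suc s) (suc x) (s<s x<s) = s<s (punchIn<pivot s x x<s)

punchIn<pivot⁻¹ : ∀ {n} (s : Fin (suc n)) (x : Fin n) → punchIn s x <ᶠ s → toℕ x < toℕ s
punchIn<pivot⁻¹ (suc s) zero    _         = z<s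
punchIn<pivot⁻¹ (suc s) (suc x) (s<s x<s) = s<s (punchIn<pivot⁻¹ s x x<s)

module _ {n} (σ : Perm (suc n)) where

  private
    σ₀ : Fin (suc n)
    σ₀ = fun σ zero

    τ : Perm n
    τ = removeHead σ

    σ-suc : ∀ j → fun σ (suc j) ≡ punchIn σ₀ (fun τ j)
    σ-suc j = sym (punchIn-removeHead σ j)

  code-head : code σ zero ≡ toℕ σ₀
  code-head = begin
    count (λ j → inversion? σ zero (suc j))
      ≡⟨ count-cong (λ j → inversion? σ zero (suc j)) (λ j → toℕ (fun τ j) <? toℕ σ₀)
           (λ {j} (_ , lt) → punchIn<pivot⁻¹ σ₀ (fun τ j) (subst (_<ᶠ σ₀) (σ-suc j) lt))
           (λ {j} lt → z<s , subst (_<ᶠ σ₀) (sym (σ-suc j)) (punchIn<pivot σ₀ (fun τ j) lt)) ⟩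
    count (λ j → toℕ (fun τ j) <? toℕ σ₀)
      ≡⟨ count-permute (λ x → toℕ x <? toℕ σ₀) τ ⟩
    count (λ (x : Fin n) → toℕ x <? toℕ σ₀)
      ≡⟨ count-below {n} (toℕ σ₀) (Fin.toℕ≤pred[n] σ₀) ⟩
    toℕ σ₀ ∎
    where open ≡-Reasoning

  code-removeHead : ∀ i → code σ (suc i) ≡ code τ i
  code-removeHead i = count-cong (λ j → inversion? σ (suc i) (suc j)) (inversion? τ i)
    (λ {j} (i<j , σj<σi) → s<s⁻¹ i<j ,
       punchIn-cancel-< σ₀ (fun τ j) (fun τ i) (subst₂ _<ᶠ_ (σ-suc j) (σ-suc i) σj<σi))
    (λ {j} (i<j , τj<τi) → s<s i<j ,
       subst₂ _<ᶠ_ (sym (σ-suc j)) (sym (σ-suc i)) (punchIn-mono-< σ₀ (fun τ j) (fun τ i) τj<τi))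

code-injective : ∀ {n} (σ τ : Perm n) → (∀ i → code σ i ≡ code τ i) → σ ≈ₚ τ
code-injective {suc n} σ τ same = σ≈τ
  where
  heads : fun σ zero ≡ fun τ zero
  heads = Fin.toℕ-injective (trans (sym (code-head σ)) (trans (same zero) (code-head τ)))
  tails : removeHead σ ≈ₚ removeHead τ
  tails = code-injective (removeHead σ) (removeHead τ)
            (λ i → trans (sym (code-removeHead σ i)) (trans (same (suc i)) (code-removeHead τ i)))
  σ≈τ : σ ≈ₚ τ
  σ≈τ zero    = heads
  σ≈τ (suc j) = begin
    fun σ (suc j)                                ≡⟨ punchIn-removeHead σ j ⟨
    punchIn (fun σ zero) (fun (removeHead σ) j)  ≡⟨ cong₂ punchIn heads (tails j) ⟩
    punchIn (fun τ zero) (fun (removeHead τ) j)  ≡⟨ punchIn-removeHead τ j ⟩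
    fun τ (suc j)                                ∎
    where open ≡-Reasoning

CodeBounded : ∀ {n} → (Fin n → ℕ) → Set
CodeBounded {n} c = ∀ i → c i ≤ n ∸ suc (toℕ i)

code-bounded : ∀ {n} (σ : Perm n) → CodeBounded (code σ)
code-bounded {n} σ i = begin
  code σ i                                 ≤⟨ count-mono (inversion? σ i) (λ j → i Fin.<? j) proj₁ ⟩
  count (λ (j : Fin n) → toℕ i <? toℕ j)   ≡⟨ count-above {n} (toℕ i) ⟩
  n ∸ suc (toℕ i)                          ∎
  where open ≤-Reasoning

code≤value : ∀ {n} (σ : Perm n) i → code σ i ≤ toℕ (fun σ i)
code≤value {n} σ i = begin
  code σ i                                 ≤⟨ count-mono (inversion? σ i) (λ j → fun σ j Fin.<? σi) proj₂ ⟩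
  count (λ j → fun σ j Fin.<? σi)          ≡⟨ count-permute (λ x → x Fin.<? σi) σ ⟩
  count (λ (x : Fin n) → toℕ x <? toℕ σi)  ≡⟨ count-below {n} (toℕ σi) (<⇒≤ (Fin.toℕ<n σi)) ⟩
  toℕ σi                                   ∎
  where
  open ≤-Reasoning
  σi : Fin n
  σi = fun σ i

decode : ∀ {n} (c : Fin n → ℕ) → CodeBounded c → Perm n
decode {zero}  c bounded = record { fun = λ () ; inj = λ { {()} } }
decode {suc n} c bounded = insertHead (fromℕ< (s≤s (bounded zero))) (decode (c ∘ suc) (bounded ∘ suc))

code-decode : ∀ {n} (c : Fin n → ℕ) (bounded : CodeBounded c) i → code (decode c bounded) i ≡ c i
code-decode {suc n} c bounded zero    = trans (code-head (decode c bounded)) (Fin.toℕ-fromℕ< (s≤s (bounded zero)))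
code-decode {suc n} c bounded (suc i) = begin
  code (decode c bounded) (suc i)             ≡⟨ code-removeHead (decode c bounded) i ⟩
  code (removeHead (decode c bounded)) i      ≡⟨ code-cong (removeHead (decode c bounded)) tail
                                                   (removeHead-insertHead (fromℕ< (s≤s (bounded zero))) tail) i ⟩
  code tail i                                 ≡⟨ code-decode (c ∘ suc) (bounded ∘ suc) i ⟩
  c (suc i)                                   ∎
  where
  open ≡-Reasoning
  tail : Perm n
  tail = decode (c ∘ suc) (bounded ∘ suc)

-- 132-avoidance and inversions

Antitone : ∀ {n} → (Fin n → ℕ) → Set
Antitone c = ∀ i j → i <ᶠ j → c j ≤ c i

module _ {n} (σ : Perm n) where

  private
    values-differ : ∀ {a b} → a <ᶠ b → toℕ (fun σ a) ≢ toℕ (fun σ b)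
    values-differ a<b eq = <⇒≢ a<b (cong toℕ (inj σ (Fin.toℕ-injective eq)))

  avoids132⇒antitone : Avoids132 σ → Antitone (code σ)
  avoids132⇒antitone avoids i j i<j with <-cmp (toℕ (fun σ i)) (toℕ (fun σ j))
  ... | tri≈ _ eq _    = contradiction eq (values-differ i<j)
  ... | tri> _ _ σj<σi = count-mono (inversion? σ j) (inversion? σ i)
                           (λ (j<x , σx<σj) → <-trans i<j j<x , <-trans σx<σj σj<σi)
  ... | tri< σi<σj _ _ with code σ j ≤? code σ i
  ...   | yes ok = ok
  ...   | no ¬ok with count-witness (inversion? σ j) (inversion? σ i) (≰⇒> ¬ok)
  ...     | x , (j<x , σx<σj) , ¬inversion-i = ⊥-elim (avoids (i , j , x , i<j , j<x , σi<σx , σx<σj))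
    where
    σi<σx : fun σ i <ᶠ fun σ x
    σi<σx = ≤∧≢⇒< (≮⇒≥ (λ σx<σi → ¬inversion-i (<-trans i<j j<x , σx<σi)))
                  (values-differ (<-trans i<j j<x))

  antitone⇒avoids132 : Antitone (code σ) → Avoids132 σ
  antitone⇒avoids132 anti (j , k , l , j<k , k<l , σj<σl , σl<σk) = no132 _ j ≤-refl j<k σj<σl
    where
    -- A 132-pattern (j, k, l) forces code j < code k, unless some x between j and k starts the
    -- closer pattern (x, k, l); so induct on k - j.
    no132 : ∀ d j → toℕ k ∸ toℕ j ≤ d → j <ᶠ k → fun σ j <ᶠ fun σ l → ⊥
    no132 zero    j gap j<k _     = <⇒≱ (m<n⇒0<n∸m j<k) gap
    no132 (suc d) j gap j<k σj<σl = <⇒≱ code-j<code-k (anti j k j<k)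
      where
      inversion-j⇒k : ∀ {x} → Inversion σ j x → Inversion σ k x
      inversion-j⇒k {x} (j<x , σx<σj) with <-cmp (toℕ x) (toℕ k)
      ... | tri< x<k _ _ = ⊥-elim (no132 d x (s≤s⁻¹ (<-≤-trans (∸-monoʳ-< j<x (<⇒≤ x<k)) gap))
                                         x<k (<-trans σx<σj σj<σl))
      ... | tri≈ _ x≡k _ = ⊥-elim (<-asym (subst (λ y → fun σ y <ᶠ fun σ j) (Fin.toℕ-injective x≡k) σx<σj)
                                          (<-trans σj<σl σl<σk))
      ... | tri> _ _ k<x = k<x , <-trans σx<σj (<-trans σj<σl σl<σk)
      code-j<code-k : code σ j < code σ k
      code-j<code-k = count-strict (inversion? σ j) (inversion? σ k) inversion-j⇒k l (k<l , σl<σk)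
                        (λ (_ , σl<σj) → <-asym σl<σj σj<σl)

inv≡sum-code : ∀ {n} (σ : Perm n) → inv σ ≡ sum (code σ)
inv≡sum-code {n} σ = trans (length-filterᵇ-cartesianProduct {n} inversionᵇ (λ i → i) (allFin n))
                           (sum-cong-≗ (λ i → length-filterᵇ-tabulate (inversion? σ i) (λ j → j)))
  where
  inversionᵇ : Fin n × Fin n → Bool
  inversionᵇ (i , j) = does (inversion? σ i j)

-- Bruhat order and codes

-- Bruhat steps can only decrease these counts.  When σ has an antitone code the corner below
-- (i+1, code σ i) is empty, and an empty corner below (i+1, k) forces k ≤ code τ i.
cornerCount : ∀ {n} → Perm n → ℕ → ℕ → ℕ
cornerCount σ x k = count (λ a → (toℕ a <? x) ×-dec (toℕ (fun σ a) <? k))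

cornerCount-step : ∀ {n} (σ τ : Perm n) → BruhatStep σ τ → ∀ x k → cornerCount τ x k ≤ cornerCount σ x k
cornerCount-step {n} σ τ (i , j , i<j , σi<σj , τ≗σ∘t) x k with x ≤? toℕ j
... | yes x≤j = count-mono (λ a → (toℕ a <? x) ×-dec (toℕ (fun τ a) <? k))
                          (λ a → (toℕ a <? x) ×-dec (toℕ (fun σ a) <? k)) τ-in⇒σ-in
  where
  τ-in⇒σ-in : ∀ {a} → toℕ a < x × toℕ (fun τ a) < k → toℕ a < x × toℕ (fun σ a) < k
  τ-in⇒σ-in {a} (a<x , τa<k) with transposeView i j a
  ... | at-i          = a<x , <-trans σi<σj
                                          (subst (λ b → toℕ b < k) (trans (τ≗σ∘t i) (cong (fun σ) (transpose-i i j))) τa<k)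
  ... | at-j          = contradiction x≤j (<⇒≱ a<x)
  ... | other a≢i a≢j = a<x , subst (λ b → toℕ b < k) (trans (τ≗σ∘t a) (cong (fun σ) (transpose-other i j a a≢i a≢j)))
                                      τa<k
... | no x≰j = ≤-reflexive (begin
  cornerCount τ x k
    ≡⟨ count-cong (λ a → (toℕ a <? x) ×-dec (toℕ (fun τ a) <? k)) (σ-in? ∘ transpose i j)
         (λ {a} (a<x , τa<k) → stays-inside a a<x , subst (λ b → toℕ b < k) (τ≗σ∘t a) τa<k)
         (λ {a} (ta<x , σta<k) → stays-inside⁻¹ a ta<x , subst (λ b → toℕ b < k) (sym (τ≗σ∘t a)) σta<k) ⟩
  count (σ-in? ∘ transpose i j)
    ≡⟨ count-permute σ-in? (transposition i j) ⟩
  cornerCount σ x k ∎)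
  where
  open ≡-Reasoning
  j<x : toℕ j < x
  j<x = ≰⇒> x≰j
  σ-in? : Decidable (λ a → toℕ a < x × toℕ (fun σ a) < k)
  σ-in? a = (toℕ a <? x) ×-dec (toℕ (fun σ a) <? k)
  stays-inside : ∀ a → toℕ a < x → toℕ (transpose i j a) < x
  stays-inside a a<x with transposeView i j a
  ... | at-i          = subst (λ b → toℕ b < x) (sym (transpose-i i j)) j<x
  ... | at-j          = subst (λ b → toℕ b < x) (sym (transpose-j i j)) (<-trans i<j j<x)
  ... | other a≢i a≢j = subst (λ b → toℕ b < x) (sym (transpose-other i j a a≢i a≢j)) a<x
  stays-inside⁻¹ : ∀ a → toℕ (transpose i j a) < x → toℕ a < x
  stays-inside⁻¹ a ta<x with transposeView i j a
  ... | at-i          = <-trans i<j j<x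
  ... | at-j          = j<x
  ... | other a≢i a≢j = subst (λ b → toℕ b < x) (transpose-other i j a a≢i a≢j) ta<x

cornerCount-antitone : ∀ {n} {σ τ : Perm n} → σ ≤B τ → ∀ x k → cornerCount τ x k ≤ cornerCount σ x k
cornerCount-antitone {σ = σ} {τ} (refl≈ σ≈τ) x k = count-mono
  (λ a → (toℕ a <? x) ×-dec (toℕ (fun τ a) <? k)) (λ a → (toℕ a <? x) ×-dec (toℕ (fun σ a) <? k))
  (λ {a} (a<x , τa<k) → a<x , subst (λ b → toℕ b < k) (sym (σ≈τ a)) τa<k)
cornerCount-antitone {τ = τ} (step {ρ = ρ} σ≤ρ ρ→τ) x k =
  ≤-trans (cornerCount-step ρ τ ρ→τ x k) (cornerCount-antitone σ≤ρ x k)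

cornerCount-code : ∀ {n} (σ : Perm n) → Antitone (code σ) → ∀ i → cornerCount σ (suc (toℕ i)) (code σ i) ≡ 0
cornerCount-code σ anti i = count-none (λ a → (toℕ a <? suc (toℕ i)) ×-dec (toℕ (fun σ a) <? code σ i))
  (λ a (a≤i , σa<code) → <⇒≱ σa<code (≤-trans (code-i≤code-a a (s≤s⁻¹ a≤i)) (code≤value σ a)))
  where
  code-i≤code-a : ∀ a → toℕ a ≤ toℕ i → code σ i ≤ code σ a
  code-i≤code-a a a≤i with m≤n⇒m<n∨m≡n a≤i
  ... | inj₁ a<i = anti a i a<i
  ... | inj₂ a≡i = ≤-reflexive (cong (code σ) (sym (Fin.toℕ-injective a≡i)))

≤-code-of-empty-corner : ∀ {n} (τ : Perm n) i k → k ≤ n → cornerCount τ (suc (toℕ i)) k ≡ 0 → k ≤ code τ i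
≤-code-of-empty-corner {n} τ i k k≤n empty = begin
  k                                      ≡⟨ count-below k k≤n ⟨
  count (λ (x : Fin n) → toℕ x <? k)     ≡⟨ count-permute (λ x → toℕ x <? k) τ ⟨
  count (λ a → toℕ (fun τ a) <? k)       ≤⟨ count-mono (λ a → toℕ (fun τ a) <? k) (inversion? τ i)
                                                         below-k⇒inversion ⟩
  code τ i                               ∎
  where
  open ≤-Reasoning
  outside : ∀ a → toℕ a ≤ toℕ i → ¬ toℕ (fun τ a) < k
  outside a a≤i τa<k = count≡0⇒none (λ a → (toℕ a <? suc (toℕ i)) ×-dec (toℕ (fun τ a) <? k)) empty a
                                     (s≤s a≤i , τa<k)
  below-k⇒inversion : ∀ {a} → toℕ (fun τ a) < k → Inversion τ i a
  below-k⇒inversion {a} τa<k = ≰⇒> (λ a≤i → outside a a≤i τa<k)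
                             , <-≤-trans τa<k (≮⇒≥ (outside i ≤-refl))

bruhat⇒code-≤ : ∀ {n} {σ τ : Perm n} → Antitone (code σ) → σ ≤B τ → ∀ i → code σ i ≤ code τ i
bruhat⇒code-≤ {n} {σ} {τ} anti σ≤τ i = ≤-code-of-empty-corner τ i (code σ i)
  (≤-trans (code-bounded σ i) (m∸n≤m n (suc (toℕ i))))
  (n≤0⇒n≡0 (≤-trans (cornerCount-antitone σ≤τ (suc (toℕ i)) (code σ i))
                    (≤-reflexive (cornerCount-code σ anti i))))

-- If σ j is the smallest value above σ i at a position after i, swapping positions i and j
-- raises the code at i by one and leaves every other code entry unchanged.
module _ {n} (σ : Perm n) (i j : Fin n) (i<j : i <ᶠ j) (σi<σj : fun σ i <ᶠ fun σ j)
         (gap : ∀ m → i <ᶠ m → fun σ i <ᶠ fun σ m → toℕ (fun σ j) ≤ toℕ (fun σ m)) where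

  private
    τ : Perm n
    τ = swap σ i j

    τ-i : fun τ i ≡ fun σ j
    τ-i = cong (fun σ) (transpose-i i j)

    τ-j : fun τ j ≡ fun σ i
    τ-j = cong (fun σ) (transpose-j i j)

    τ-other : ∀ {x} → x ≢ i → x ≢ j → fun τ x ≡ fun σ x
    τ-other {x} x≢i x≢j = cong (fun σ) (transpose-other i j x x≢i x≢j)

    distinct : ∀ {a b} → a ≢ b → toℕ (fun σ a) ≢ toℕ (fun σ b)
    distinct a≢b eq = a≢b (inj σ (Fin.toℕ-injective eq))

    <⇒≢ᶠ : ∀ {a b : Fin n} → a <ᶠ b → b ≢ a
    <⇒≢ᶠ a<b refl = <-irrefl refl a<b

    below-j⇒below-i : ∀ x → i <ᶠ x → fun σ x <ᶠ fun σ j → fun σ x <ᶠ fun σ i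
    below-j⇒below-i x i<x σx<σj with <-cmp (toℕ (fun σ x)) (toℕ (fun σ i))
    ... | tri< σx<σi _ _ = σx<σi
    ... | tri≈ _ eq _    = contradiction eq (distinct (<⇒≢ᶠ i<x))
    ... | tri> _ _ σi<σx = contradiction σx<σj (≤⇒≯ (gap x i<x σi<σx))

    above-i⇒above-j : ∀ x → i <ᶠ x → x ≢ j → fun σ i <ᶠ fun σ x → fun σ j <ᶠ fun σ x
    above-i⇒above-j x i<x x≢j σi<σx = ≤∧≢⇒< (gap x i<x σi<σx) (distinct (x≢j ∘ sym))

  code-swap-i : code τ i ≡ suc (code σ i)
  code-swap-i = count-suc (inversion? τ i) (inversion? σ i) j τ⇒σ σ⇒τ
    (i<j , subst₂ _<ᶠ_ (sym τ-j) (sym τ-i) σi<σj) (λ (_ , σj<σi) → <-asym σj<σi σi<σj)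
    where
    τ⇒σ : ∀ {x} → x ≢ j → Inversion τ i x → Inversion σ i x
    τ⇒σ {x} x≢j (i<x , τx<τi) =
      i<x , below-j⇒below-i x i<x (subst₂ _<ᶠ_ (τ-other (<⇒≢ᶠ i<x) x≢j) τ-i τx<τi)
    σ⇒τ : ∀ {x} → x ≢ j → Inversion σ i x → Inversion τ i x
    σ⇒τ {x} x≢j (i<x , σx<σi) =
      i<x , subst₂ _<ᶠ_ (sym (τ-other (<⇒≢ᶠ i<x) x≢j)) (sym τ-i) (<-trans σx<σi σi<σj)

  code-swap-other : ∀ m → m ≢ i → code τ m ≡ code σ m
  code-swap-other m m≢i with transposeView i j m
  ... | at-i = contradiction refl m≢i
  ... | at-j = count-cong (inversion? τ j) (inversion? σ j)
    (λ {x} (j<x , τx<τj) → j<x , <-trans (subst₂ _<ᶠ_ (τ-other (x≢i j<x) (<⇒≢ᶠ j<x)) τ-j τx<τj) σi<σj)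
    (λ {x} (j<x , σx<σj) → j<x , subst₂ _<ᶠ_ (sym (τ-other (x≢i j<x) (<⇒≢ᶠ j<x))) (sym τ-j)
                                   (below-j⇒below-i x (<-trans i<j j<x) σx<σj))
    where
    x≢i : ∀ {x} → j <ᶠ x → x ≢ i
    x≢i j<x = <⇒≢ᶠ (<-trans i<j j<x)
  ... | other m≢i′ m≢j with <-cmp (toℕ m) (toℕ i)
  ...   | tri≈ _ m≡i _ = contradiction (Fin.toℕ-injective m≡i) m≢i
  ...   | tri< m<i _ _ = trans
          (count-cong (inversion? τ m) (inversion? σ m ∘ transpose i j)
            (λ {x} (m<x , τx<τm) → stays-after x m<x , subst (fun τ x <ᶠ_) (τ-other m≢i′ m≢j) τx<τm)
            (λ {x} (m<tx , σtx<σm) → stays-after⁻¹ x m<tx ,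
              subst (fun τ x <ᶠ_) (sym (τ-other m≢i′ m≢j)) σtx<σm))
          (count-permute (inversion? σ m) (transposition i j))
    where
    stays-after : ∀ x → m <ᶠ x → m <ᶠ transpose i j x
    stays-after x m<x with transposeView i j x
    ... | at-i          = subst (m <ᶠ_) (sym (transpose-i i j)) (<-trans m<i i<j)
    ... | at-j          = subst (m <ᶠ_) (sym (transpose-j i j)) m<i
    ... | other x≢i x≢j = subst (m <ᶠ_) (sym (transpose-other i j x x≢i x≢j)) m<x
    stays-after⁻¹ : ∀ x → m <ᶠ transpose i j x → m <ᶠ x
    stays-after⁻¹ x m<tx with transposeView i j x
    ... | at-i          = m<i
    ... | at-j          = <-trans m<i i<j
    ... | other x≢i x≢j = subst (m <ᶠ_) (transpose-other i j x x≢i x≢j) m<tx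
  ...   | tri> _ _ i<m = count-cong (inversion? τ m) (inversion? σ m) τ⇒σ σ⇒τ
    where
    τm≡σm : fun τ m ≡ fun σ m
    τm≡σm = τ-other m≢i′ m≢j
    τ⇒σ : ∀ {x} → Inversion τ m x → Inversion σ m x
    τ⇒σ {x} (m<x , τx<τm) with transposeView i j x
    ... | at-i          = contradiction (<-trans i<m m<x) (<-irrefl refl)
    ... | at-j          = m<x , above-i⇒above-j m i<m m≢j (subst₂ _<ᶠ_ τ-j τm≡σm τx<τm)
    ... | other x≢i x≢j = m<x , subst₂ _<ᶠ_ (τ-other x≢i x≢j) τm≡σm τx<τm
    σ⇒τ : ∀ {x} → Inversion σ m x → Inversion τ m x
    σ⇒τ {x} (m<x , σx<σm) with transposeView i j x
    ... | at-i          = contradiction (<-trans i<m m<x) (<-irrefl refl)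
    ... | at-j          = m<x , subst₂ _<ᶠ_ (sym τ-j) (sym τm≡σm) (<-trans σi<σj σx<σm)
    ... | other x≢i x≢j = m<x , subst₂ _<ᶠ_ (sym (τ-other x≢i x≢j)) (sym τm≡σm) σx<σm

raise : ∀ {n} (σ : Perm n) i → code σ i < n ∸ suc (toℕ i) →
        ∃ λ j → i <ᶠ j × fun σ i <ᶠ fun σ j × UnitStep (code σ) (code (swap σ i j)) i
raise {n} σ i code<max = j , i<j , σi<σj , code-swap-i σ i j i<j σi<σj gap , code-swap-other σ i j i<j σi<σj gap
  where
  Above : Fin n → Set
  Above m = i <ᶠ m × fun σ i <ᶠ fun σ m
  above? : Decidable Above
  above? m = (i Fin.<? m) ×-dec (fun σ i Fin.<? fun σ m)
  some-above : ∃ Above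
  some-above with count-witness (λ m → i Fin.<? m) (inversion? σ i)
                                (subst (code σ i <_) (sym (count-above {n} (toℕ i))) code<max)
  ... | m , i<m , ¬inversion = m , i<m , ≤∧≢⇒< (≮⇒≥ (λ σm<σi → ¬inversion (i<m , σm<σi)))
                                                (λ eq → <⇒≢ i<m (cong toℕ (inj σ (Fin.toℕ-injective eq))))
  lowest : ∃ λ j → Above j × ∀ m → Above m → toℕ (fun σ j) ≤ toℕ (fun σ m)
  lowest = argmin above? (toℕ ∘ fun σ) some-above
  j : Fin n
  j = proj₁ lowest
  i<j : i <ᶠ j
  i<j = proj₁ (proj₁ (proj₂ lowest))
  σi<σj : fun σ i <ᶠ fun σ j
  σi<σj = proj₂ (proj₁ (proj₂ lowest))
  gap : ∀ m → i <ᶠ m → fun σ i <ᶠ fun σ m → toℕ (fun σ j) ≤ toℕ (fun σ m)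
  gap m i<m σi<σm = proj₂ (proj₂ lowest) m (i<m , σi<σm)

lower-bruhat : ∀ {n} (σ τ : Perm n) → (∀ i → code σ i ≤ code τ i) → (∃ λ i → code σ i < code τ i) →
               Σ (Perm n) λ τ′ → Σ (Fin n) λ i →
                 code σ i < code τ i × UnitStep (code τ′) (code τ) i × BruhatStep τ′ τ
lower-bruhat {n} σ τ _ (i , σi<τi) = τ′ , i , σi<τi , unit , i , j , i<j , τ′i<τ′j , λ k → sym (swap≈τ k)
  where
  c′ : Fin n → ℕ
  c′ = updateAt (code τ) i pred
  c′-unit : UnitStep c′ (code τ) i
  c′-unit = unitStep-pred (code τ) i (≤-<-trans z≤n σi<τi)
  τ′ : Perm n
  τ′ = decode c′ (λ k → ≤-trans (unitStep-≤ c′-unit k) (code-bounded τ k))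
  unit : UnitStep (code τ′) (code τ) i
  unit = unitStep-cong (λ k → sym (code-decode c′ _ k)) (λ _ → refl) c′-unit
  raised : ∃ λ j → i <ᶠ j × fun τ′ i <ᶠ fun τ′ j × UnitStep (code τ′) (code (swap τ′ i j)) i
  raised = raise τ′ i (<-≤-trans (unitStep-< unit) (code-bounded τ i))
  j : Fin n
  j = proj₁ raised
  i<j : i <ᶠ j
  i<j = proj₁ (proj₂ raised)
  τ′i<τ′j : fun τ′ i <ᶠ fun τ′ j
  τ′i<τ′j = proj₁ (proj₂ (proj₂ raised))
  swap≈τ : swap τ′ i j ≈ₚ τ
  swap≈τ = code-injective (swap τ′ i j) τ (unitStep-unique (proj₂ (proj₂ (proj₂ raised))) unit)

code-≤⇒bruhat : ∀ {n} (σ τ : Perm n) → (∀ i → code σ i ≤ code τ i) → σ ≤B τ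
code-≤⇒bruhat σ τ = descent σ τ
  where
  open Descent code (λ σ τ _ → σ ≤B τ) BruhatStep (λ {σ} {τ} eq → refl≈ (code-injective σ τ eq))
         step lower-bruhat

-- The zigzag snake

oddTile evenTile : ℕ → ℕ
oddTile zero    = 1
oddTile (suc j) = suc (suc (oddTile j))
evenTile j = suc (oddTile j)

isOdd-oddTile : ∀ j → isOdd (oddTile j) ≡ true
isOdd-oddTile zero    = refl
isOdd-oddTile (suc j) rewrite isOdd-oddTile j = refl

half-oddTile : ∀ j → ⌊ oddTile j /2⌋ ≡ j
half-oddTile zero    = refl
half-oddTile (suc j) = cong suc (half-oddTile j)

half-evenTile : ∀ j → ⌊ evenTile j /2⌋ ≡ suc j
half-evenTile zero    = refl
half-evenTile (suc j) = cong suc (half-evenTile j)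

ll-oddTile : ∀ j → ll (oddTile j) ≡ (j , j)
ll-oddTile j rewrite isOdd-oddTile j | half-oddTile j = refl

ll-evenTile : ∀ j → ll (evenTile j) ≡ (j , suc j)
ll-evenTile j rewrite isOdd-oddTile j | half-evenTile j = refl

fEdge-oddTile : ∀ j → fEdge (oddTile j) ≡ v (suc j) j
fEdge-oddTile j rewrite isOdd-oddTile j | half-oddTile j = refl

fEdge-evenTile : ∀ j → fEdge (evenTile j) ≡ h j (suc (suc j))
fEdge-evenTile j rewrite isOdd-oddTile j | half-evenTile j = refl

data TileView (k : ℕ) : Set where
  odd  : ∀ j → k ≡ oddTile j → TileView k
  even : ∀ j → k ≡ evenTile j → TileView k

tileView : ∀ k → TileView (suc k)
tileView zero          = odd 0 refl
tileView (suc zero)    = even 0 refl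
tileView (suc (suc k)) with tileView k
... | odd j eq  = odd (suc j) (cong (2 +_) eq)
... | even j eq = even (suc j) (cong (2 +_) eq)

-- F k is the edge f_k of the statement, G k the other side of T_k at its outer labelled corner,
-- and X k the side shared by T_(k-1) and T_k (X 1 and X (N+1) are the free ends of the snake).
data SnakeEdge : Set where
  F G X : ℕ → SnakeEdge

index : SnakeEdge → ℕ
index (F k) = k
index (G k) = k
index (X k) = k

shiftˢ : SnakeEdge → SnakeEdge
shiftˢ (F k) = F (suc (suc k))
shiftˢ (G k) = G (suc (suc k))
shiftˢ (X k) = X (suc (suc k))

index-shiftˢ : ∀ s → index s ≤ index (shiftˢ s)
index-shiftˢ (F k) = m≤n+m k 2
index-shiftˢ (G k) = m≤n+m k 2
index-shiftˢ (X k) = m≤n+m k 2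

shiftᵉ : Edge → Edge
shiftᵉ (h x y) = h (suc x) (suc y)
shiftᵉ (v x y) = v (suc x) (suc y)

-- Translating by (1,1) sends the sides of T_k to those of T_(k+2).
classify : Edge → Maybe SnakeEdge
classify (h zero    zero)                = just (G 1)
classify (h zero    (suc zero))          = just (X 2)
classify (h zero    (suc (suc zero)))    = just (F 2)
classify (h zero    (suc (suc (suc _)))) = nothing
classify (h (suc _) zero)                = nothing
classify (h (suc x) (suc y))             = Maybe.map shiftˢ (classify (h x y))
classify (v zero          zero)          = just (X 1)
classify (v zero          (suc zero))    = just (G 2)
classify (v zero          (suc (suc _))) = nothing
classify (v (suc x)       (suc y))       = Maybe.map shiftˢ (classify (v x y))
classify (v (suc zero)    zero)          = just (F 1)
classify (v (suc (suc _)) zero)          = nothing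

-- Index 0 is junk, sent to an edge off the snake.
snakeEdge : SnakeEdge → Edge
snakeEdge (F 0)                   = h 1 0
snakeEdge (F 1)                   = v 1 0
snakeEdge (F 2)                   = h 0 2
snakeEdge (F (suc (suc (suc k)))) = shiftᵉ (snakeEdge (F (suc k)))
snakeEdge (G 0)                   = h 1 0
snakeEdge (G 1)                   = h 0 0
snakeEdge (G 2)                   = v 0 1
snakeEdge (G (suc (suc (suc k)))) = shiftᵉ (snakeEdge (G (suc k)))
snakeEdge (X 0)                   = h 1 0
snakeEdge (X 1)                   = v 0 0
snakeEdge (X 2)                   = h 0 1
snakeEdge (X (suc (suc (suc k)))) = shiftᵉ (snakeEdge (X (suc k)))

classify-shiftᵉ : ∀ e → classify (shiftᵉ e) ≡ Maybe.map shiftˢ (classify e)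
classify-shiftᵉ (h x y) = refl
classify-shiftᵉ (v x y) = refl

classify-shifted : ∀ s → classify (snakeEdge s) ≡ just s → classify (shiftᵉ (snakeEdge s)) ≡ just (shiftˢ s)
classify-shifted s classified = trans (classify-shiftᵉ (snakeEdge s)) (cong (Maybe.map shiftˢ) classified)

classify-snakeEdge : ∀ s → 1 ≤ index s → classify (snakeEdge s) ≡ just s
classify-snakeEdge (F 1)                   _ = refl
classify-snakeEdge (F 2)                   _ = refl
classify-snakeEdge (F (suc (suc (suc k)))) _ = classify-shifted (F (suc k)) (classify-snakeEdge (F (suc k)) (s≤s z≤n))
classify-snakeEdge (G 1)                   _ = refl
classify-snakeEdge (G 2)                   _ = refl
classify-snakeEdge (G (suc (suc (suc k)))) _ = classify-shifted (G (suc k)) (classify-snakeEdge (G (suc k)) (s≤s z≤n))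
classify-snakeEdge (X 1)                   _ = refl
classify-snakeEdge (X 2)                   _ = refl
classify-snakeEdge (X (suc (suc (suc k)))) _ = classify-shifted (X (suc k)) (classify-snakeEdge (X (suc k)) (s≤s z≤n))

snakeEdge-shiftˢ : ∀ s → 1 ≤ index s → snakeEdge (shiftˢ s) ≡ shiftᵉ (snakeEdge s)
snakeEdge-shiftˢ (F (suc k)) _ = refl
snakeEdge-shiftˢ (G (suc k)) _ = refl
snakeEdge-shiftˢ (X (suc k)) _ = refl

shifted : ∀ s {e} → 1 ≤ index s × snakeEdge s ≡ e → 1 ≤ index (shiftˢ s) × snakeEdge (shiftˢ s) ≡ shiftᵉ e
shifted s (1≤s , s≡e) = ≤-trans 1≤s (index-shiftˢ s) , trans (snakeEdge-shiftˢ s 1≤s) (cong shiftᵉ s≡e)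

classify-sound : ∀ e {s} → classify e ≡ just s → 1 ≤ index s × snakeEdge s ≡ e
classify-sound (h x y) = horizontal x y
  where
  horizontal : ∀ x y {s} → classify (h x y) ≡ just s → 1 ≤ index s × snakeEdge s ≡ h x y
  horizontal zero    zero             refl = s≤s z≤n , refl
  horizontal zero    (suc zero)       refl = s≤s z≤n , refl
  horizontal zero    (suc (suc zero)) refl = s≤s z≤n , refl
  horizontal (suc x) (suc y) eq with classify (h x y) in eq′
  horizontal (suc x) (suc y) refl | just s′ = shifted s′ (horizontal x y eq′)
classify-sound (v x y) = vertical x y
  where
  vertical : ∀ x y {s} → classify (v x y) ≡ just s → 1 ≤ index s × snakeEdge s ≡ v x y
  vertical zero       zero       refl = s≤s z≤n , refl
  vertical zero       (suc zero) refl = s≤s z≤n , refl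
  vertical (suc zero) zero       refl = s≤s z≤n , refl
  vertical (suc x) (suc y) eq with classify (v x y) in eq′
  vertical (suc x) (suc y) refl | just s′ = shifted s′ (vertical x y eq′)

snakeEdge-classify : ∀ {e s} → classify e ≡ just s → snakeEdge s ≡ e
snakeEdge-classify {e} eq = proj₂ (classify-sound e eq)

classify-G-odd : ∀ j → classify (h j j) ≡ just (G (oddTile j))
classify-G-odd zero    = refl
classify-G-odd (suc j) = cong (Maybe.map shiftˢ) (classify-G-odd j)

classify-G-even : ∀ j → classify (v j (suc j)) ≡ just (G (evenTile j))
classify-G-even zero    = refl
classify-G-even (suc j) = cong (Maybe.map shiftˢ) (classify-G-even j)

classify-F-odd : ∀ j → classify (v (suc j) j) ≡ just (F (oddTile j))
classify-F-odd zero    = refl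
classify-F-odd (suc j) = cong (Maybe.map shiftˢ) (classify-F-odd j)

classify-F-even : ∀ j → classify (h j (suc (suc j))) ≡ just (F (evenTile j))
classify-F-even zero    = refl
classify-F-even (suc j) = cong (Maybe.map shiftˢ) (classify-F-even j)

classify-X-odd : ∀ j → classify (v j j) ≡ just (X (oddTile j))
classify-X-odd zero    = refl
classify-X-odd (suc j) = cong (Maybe.map shiftˢ) (classify-X-odd j)

classify-X-even : ∀ j → classify (h j (suc j)) ≡ just (X (evenTile j))
classify-X-even zero    = refl
classify-X-even (suc j) = cong (Maybe.map shiftˢ) (classify-X-even j)

classify-below-h : ∀ j → classify (h (suc j) j) ≡ nothing
classify-below-h zero    = refl
classify-below-h (suc j) = cong (Maybe.map shiftˢ) (classify-below-h j)

classify-below-v : ∀ j → classify (v (suc (suc j)) j) ≡ nothing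
classify-below-v zero    = refl
classify-below-v (suc j) = cong (Maybe.map shiftˢ) (classify-below-v j)

classify-above-h : ∀ j → classify (h j (suc (suc (suc j)))) ≡ nothing
classify-above-h zero    = refl
classify-above-h (suc j) = cong (Maybe.map shiftˢ) (classify-above-h j)

classify-above-v : ∀ j → classify (v j (suc (suc j))) ≡ nothing
classify-above-v zero    = refl
classify-above-v (suc j) = cong (Maybe.map shiftˢ) (classify-above-v j)

tileView′ : ∀ k → 1 ≤ k → TileView k
tileView′ (suc k) _ = tileView k

data Role : Set where
  f-side g-side x-side x⁺-side : Role

roleEdge : ℕ → Role → SnakeEdge
roleEdge k f-side  = F k
roleEdge k g-side  = G k
roleEdge k x-side  = X k
roleEdge k x⁺-side = X (suc k)

sideRole : Bool → Side → Role
sideRole true  bottom = g-side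
sideRole true  right  = f-side
sideRole true  top    = x⁺-side
sideRole true  left   = x-side
sideRole false bottom = x-side
sideRole false right  = x⁺-side
sideRole false top    = f-side
sideRole false left   = g-side

roleSide : Bool → Role → Side
roleSide true  f-side  = right
roleSide true  g-side  = bottom
roleSide true  x-side  = left
roleSide true  x⁺-side = top
roleSide false f-side  = top
roleSide false g-side  = left
roleSide false x-side  = bottom
roleSide false x⁺-side = right

sideRole-roleSide : ∀ b r → sideRole b (roleSide b r) ≡ r
sideRole-roleSide true  f-side  = refl
sideRole-roleSide true  g-side  = refl
sideRole-roleSide true  x-side  = refl
sideRole-roleSide true  x⁺-side = refl
sideRole-roleSide false f-side  = refl
sideRole-roleSide false g-side  = refl
sideRole-roleSide false x-side  = refl
sideRole-roleSide false x⁺-side = refl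

tileEdge : ℕ → Side → SnakeEdge
tileEdge k s = roleEdge k (sideRole (isOdd k) s)

classify-side : ∀ {k} → TileView k → ∀ s → classify (sideEdge (ll k) s) ≡ just (tileEdge k s)
classify-side (odd j refl) s rewrite ll-oddTile j | isOdd-oddTile j = sides s
  where
  sides : ∀ s → classify (sideEdge (j , j) s) ≡ just (roleEdge (oddTile j) (sideRole true s))
  sides bottom = classify-G-odd j
  sides right  = classify-F-odd j
  sides top    = classify-X-even j
  sides left   = classify-X-odd j
classify-side (even j refl) s rewrite ll-evenTile j | isOdd-oddTile j = sides s
  where
  sides : ∀ s → classify (sideEdge (j , suc j) s) ≡ just (roleEdge (evenTile j) (sideRole false s))
  sides bottom = classify-X-even j
  sides right  = classify-X-odd (suc j)
  sides top    = classify-F-even j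
  sides left   = classify-G-even j

vertexSum : (Edge → ℕ) → Point → ℕ
vertexSum m p = ListAction.sum (map m (incident p))

VanishesOffSnake : (Edge → ℕ) → Set
VanishesOffSnake m = ∀ e → classify e ≡ nothing → m e ≡ 0

-- Each vertex of the snake is the outer corner of some T_k (on f_k and g_k) or the lower-left
-- corner ll k of some T_k, and its label candidate is k.
outerCorner : ℕ → Point
outerCorner k = if isOdd k then sideStart (ll k) right else sideStart (ll k) left

outerCorner-odd : ∀ j → outerCorner (oddTile j) ≡ (suc j , j)
outerCorner-odd j rewrite isOdd-oddTile j | half-oddTile j = refl

outerCorner-even : ∀ j → outerCorner (evenTile j) ≡ (j , suc (suc j))
outerCorner-even j rewrite isOdd-oddTile j | half-evenTile j = refl

module _ (m : Edge → ℕ) (vanishes : VanishesOffSnake m) where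

  private
    m̂ : SnakeEdge → ℕ
    m̂ = m ∘ snakeEdge

    at : ∀ e {s} → classify e ≡ just s → m̂ s ≡ m e
    at e eq = cong m (snakeEdge-classify eq)

  vertexSum-outer : ∀ {k} → TileView k → vertexSum m (outerCorner k) ≡ m̂ (F k) + m̂ (G k)
  vertexSum-outer (odd zero refl) rewrite vanishes (h 1 0) refl = cong (m (v 1 0) +_) (+-identityʳ _)
  vertexSum-outer (odd (suc j) refl)
    rewrite outerCorner-odd (suc j)
          | vanishes (h (2 + j) (suc j)) (classify-below-h (suc j)) | vanishes (v (2 + j) j) (classify-below-v j)
          | at (v (2 + j) (suc j)) (classify-F-odd (suc j)) | at (h (suc j) (suc j)) (classify-G-odd (suc j))
          = cong (m (v (2 + j) (suc j)) +_) (+-identityʳ _)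
  vertexSum-outer (even zero refl) rewrite vanishes (v 0 2) refl = cong (m (h 0 2) +_) (+-identityʳ _)
  vertexSum-outer (even (suc j) refl)
    rewrite outerCorner-even (suc j)
          | vanishes (v (suc j) (3 + j)) (classify-above-v (suc j)) | vanishes (h j (3 + j)) (classify-above-h j)
          | at (h (suc j) (3 + j)) (classify-F-even (suc j)) | at (v (suc j) (2 + j)) (classify-G-even (suc j))
          = cong (m (h (suc j) (3 + j)) +_) (+-identityʳ _)

  vertexSum-inner : ∀ {k} → TileView k →
                    vertexSum m (ll k) ≡ m̂ (G k) + (m̂ (X k) + (m̂ (X (pred k)) + m̂ (F (pred (pred k)))))
  vertexSum-inner (odd zero refl) rewrite vanishes (h 1 0) refl = refl
  vertexSum-inner (odd (suc j) refl)
    rewrite ll-oddTile (suc j)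
          | at (h (suc j) (suc j)) (classify-G-odd (suc j)) | at (v (suc j) (suc j)) (classify-X-odd (suc j))
          | at (h j (suc j)) (classify-X-even j) | at (v (suc j) j) (classify-F-odd j)
          = cong (λ d → m (h (suc j) (suc j)) + (m (v (suc j) (suc j)) + (m (h j (suc j)) + d))) (+-identityʳ _)
  vertexSum-inner (even zero refl) rewrite vanishes (h 1 0) refl = x∙yz≈y∙xz (m (h 0 1)) (m (v 0 1)) _
  vertexSum-inner (even (suc j) refl)
    rewrite ll-evenTile (suc j)
          | at (v (suc j) (2 + j)) (classify-G-even (suc j)) | at (h (suc j) (2 + j)) (classify-X-even (suc j))
          | at (v (suc j) (suc j)) (classify-X-odd (suc j)) | at (h j (2 + j)) (classify-F-even j)
          = reorder (m (v (suc j) (2 + j))) (m (h (suc j) (2 + j))) (m (v (suc j) (suc j))) (m (h j (2 + j)))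
    where
    reorder : ∀ a b c d → b + (a + (d + (c + 0))) ≡ a + (b + (c + d))
    reorder = solve-∀

private
  2+2*j≡2*[1+j] : ∀ j → 2 + 2 * j ≡ 2 * (1 + j)
  2+2*j≡2*[1+j] = solve-∀

evenTile≡ : ∀ j → evenTile j ≡ 2 * suc j
oddTile≡ : ∀ j → oddTile j ≡ suc (2 * j)
oddTile≡ zero    = refl
oddTile≡ (suc j) = cong suc (evenTile≡ j)
evenTile≡ j = trans (cong suc (oddTile≡ j)) (2+2*j≡2*[1+j] j)

labelCand-inner : ∀ {k} → TileView k → labelCand (ll k) ≡ k
labelCand-inner (odd j refl) rewrite ll-oddTile j | dec-true (j ≟ j) refl = sym (oddTile≡ j)
labelCand-inner (even j refl)
  rewrite ll-evenTile j | dec-false (j ≟ suc j) (m≢1+n+m j {0}) | dec-false (j ≟ suc (suc j)) (m≢1+n+m j {1})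
        | dec-true (suc j ≟ suc j) refl = sym (evenTile≡ j)

labelCand-outer : ∀ {k} → TileView k → labelCand (outerCorner k) ≡ k
labelCand-outer (odd j refl)
  rewrite outerCorner-odd j | dec-false (suc j ≟ j) 1+n≢n | dec-true (suc j ≟ suc j) refl = sym (oddTile≡ j)
labelCand-outer (even j refl)
  rewrite outerCorner-even j | dec-false (j ≟ suc (suc j)) (m≢1+n+m j {1})
        | dec-false (j ≟ suc (suc (suc j))) (m≢1+n+m j {2})
        | dec-false (suc j ≟ suc (suc j)) (m≢1+n+m (suc j) {0}) | dec-true (suc (suc j) ≟ suc (suc j)) refl
  = sym (evenTile≡ j)

corner-odd : ∀ j s → sideStart (ll (oddTile j)) s ≡ sideStart (j , j) s
corner-odd j s = cong (λ p → sideStart p s) (ll-oddTile j)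

corner-even : ∀ j s → sideStart (ll (evenTile j)) s ≡ sideStart (j , suc j) s
corner-even j s = cong (λ p → sideStart p s) (ll-evenTile j)

tile-corners : ∀ {k} → TileView k → ∀ s →
               sideStart (ll k) s ≡ outerCorner k ⊎ ∃ λ d → d ≤ 2 × sideStart (ll k) s ≡ ll (d + k)
tile-corners (odd j refl)  bottom = inj₂ (0 , z≤n , refl)
tile-corners (odd j refl)  right  = inj₁ (trans (corner-odd j right) (sym (outerCorner-odd j)))
tile-corners (odd j refl)  top    = inj₂ (2 , ≤-refl , trans (corner-odd j top) (sym (ll-oddTile (suc j))))
tile-corners (odd j refl)  left   = inj₂ (1 , s≤s z≤n , trans (corner-odd j left) (sym (ll-evenTile j)))
tile-corners (even j refl) bottom = inj₂ (0 , z≤n , refl)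
tile-corners (even j refl) right  = inj₂ (1 , s≤s z≤n , trans (corner-even j right) (sym (ll-oddTile (suc j))))
tile-corners (even j refl) top    = inj₂ (2 , ≤-refl , trans (corner-even j top) (sym (ll-evenTile (suc j))))
tile-corners (even j refl) left   = inj₁ (trans (corner-even j left) (sym (outerCorner-even j)))

inner-corners : ∀ {k} → TileView k → ∀ d → d ≤ 2 → Σ Side λ s → sideStart (ll k) s ≡ ll (d + k)
inner-corners (odd j refl)  0                   _ = bottom , refl
inner-corners (odd j refl)  1                   _ = left , trans (corner-odd j left) (sym (ll-evenTile j))
inner-corners (odd j refl)  2                   _ = top , trans (corner-odd j top) (sym (ll-oddTile (suc j)))
inner-corners (even j refl) 0                   _ = bottom , refl
inner-corners (even j refl) 1                   _ = right , trans (corner-even j right) (sym (ll-oddTile (suc j)))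
inner-corners (even j refl) 2                   _ = top , trans (corner-even j top) (sym (ll-evenTile (suc j)))
inner-corners _             (suc (suc (suc _))) (s≤s (s≤s ()))

-- Covers and height sequences

InRange : ℕ → SnakeEdge → Set
InRange N (F k) = 1 ≤ k × k ≤ N
InRange N (G k) = 1 ≤ k × k ≤ N
InRange N (X k) = 1 ≤ k × k ≤ suc N

inRange? : ∀ N s → Dec (InRange N s)
inRange? N (F k) = (1 ≤? k) ×-dec (k ≤? N)
inRange? N (G k) = (1 ≤? k) ×-dec (k ≤? N)
inRange? N (X k) = (1 ≤? k) ×-dec (k ≤? suc N)

G-beyond : ∀ {N} → ¬ InRange N (G (2 + N))
G-beyond (_ , 2+N≤N) = 1+n≰n (<⇒≤ 2+N≤N)

X-beyond : ∀ {N} → ¬ InRange N (X (2 + N))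
X-beyond (_ , 2+N≤1+N) = 1+n≰n 2+N≤1+N

index-inRange : ∀ {N} s → InRange N s → 1 ≤ index s
index-inRange (F _) = proj₁
index-inRange (G _) = proj₁
index-inRange (X _) = proj₁

roleEdge-inRange : ∀ {N k} → 1 ≤ k → k ≤ N → ∀ r → InRange N (roleEdge k r)
roleEdge-inRange 1≤k k≤N f-side  = 1≤k , k≤N
roleEdge-inRange 1≤k k≤N g-side  = 1≤k , k≤N
roleEdge-inRange 1≤k k≤N x-side  = 1≤k , m≤n⇒m≤1+n k≤N
roleEdge-inRange 1≤k k≤N x⁺-side = s≤s z≤n , s≤s k≤N

isEdge-classify : ∀ {N e} → IsEdge N e → Σ SnakeEdge λ s → classify e ≡ just s × InRange N s
isEdge-classify (k , (1≤k , k≤N) , s , refl) =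
  tileEdge k s , classify-side (tileView′ k 1≤k) s , roleEdge-inRange 1≤k k≤N (sideRole (isOdd k) s)

sideEdge-roleSide : ∀ {k} → TileView k → ∀ r → sideEdge (ll k) (roleSide (isOdd k) r) ≡ snakeEdge (roleEdge k r)
sideEdge-roleSide {k} view r = sym (snakeEdge-classify
  (trans (classify-side view (roleSide (isOdd k) r)) (cong (just ∘ roleEdge k) (sideRole-roleSide (isOdd k) r))))

inRange-isEdge : ∀ {N} → 1 ≤ N → ∀ s → InRange N s → IsEdge N (snakeEdge s)
inRange-isEdge _ (F k) (1≤k , k≤N) = k , (1≤k , k≤N) , _ , sideEdge-roleSide (tileView′ k 1≤k) f-side
inRange-isEdge _ (G k) (1≤k , k≤N) = k , (1≤k , k≤N) , _ , sideEdge-roleSide (tileView′ k 1≤k) g-side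
inRange-isEdge {N} 1≤N (X k) (1≤k , k≤1+N) with m≤n⇒m<n∨m≡n k≤1+N
... | inj₁ k<1+N = k , (1≤k , s≤s⁻¹ k<1+N) , _ , sideEdge-roleSide (tileView′ k 1≤k) x-side
... | inj₂ refl  = N , (1≤N , ≤-refl) , _ , sideEdge-roleSide (tileView′ N 1≤N) x⁺-side

isEdge-inRange : ∀ {N} s → IsEdge N (snakeEdge s) → InRange N s
isEdge-inRange {N} s isEdge with isEdge-classify isEdge
... | s′ , classified-s′ , s′-inRange = classified s classified-s′ s′-inRange
  where
  classified : ∀ s {s′} → classify (snakeEdge s) ≡ just s′ → InRange N s′ → InRange N s
  classified (F zero) ()
  classified (G zero) ()
  classified (X zero) ()
  classified s@(F (suc _)) eq = subst (InRange N) (just-injective (trans (sym eq) (classify-snakeEdge s (s≤s z≤n))))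
  classified s@(G (suc _)) eq = subst (InRange N) (just-injective (trans (sym eq) (classify-snakeEdge s (s≤s z≤n))))
  classified s@(X (suc _)) eq = subst (InRange N) (just-injective (trans (sym eq) (classify-snakeEdge s (s≤s z≤n))))

private
  label-inside : ∀ N p {k} → labelCand p ≡ k → 1 ≤ k → k ≤ N → label N p ≡ k
  label-inside N p eq 1≤k k≤N rewrite eq
    | Equivalence.to T-≡ (Equivalence.from T-∧ (≤⇒≤ᵇ 1≤k , ≤⇒≤ᵇ k≤N)) = refl

  label-outside : ∀ N p {k} → labelCand p ≡ k → N < k → label N p ≡ suc N
  label-outside N p {suc k} eq N<k rewrite eq with suc k ≤ᵇ N in k≤ᵇN
  ... | true  = contradiction (≤ᵇ⇒≤ (suc k) N (subst T (sym k≤ᵇN) tt)) (<⇒≱ N<k)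
  ... | false = refl

label-outer : ∀ N k → 1 ≤ k → k ≤ N → label N (outerCorner k) ≡ k
label-outer N k 1≤k = label-inside N (outerCorner k) (labelCand-outer (tileView′ k 1≤k)) 1≤k

label-inner : ∀ N k → 1 ≤ k → k ≤ suc N → label N (ll k) ≡ k
label-inner N k 1≤k k≤1+N with k ≤? N
... | yes k≤N = label-inside N (ll k) (labelCand-inner (tileView′ k 1≤k)) 1≤k k≤N
... | no k≰N  = trans (label-outside N (ll k) (labelCand-inner (tileView′ k 1≤k)) (≰⇒> k≰N))
                      (≤-antisym (≰⇒> k≰N) k≤1+N)

label-beyond : ∀ N → label N (ll (2 + N)) ≡ suc N
label-beyond N = label-outside N (ll (2 + N)) (labelCand-inner (tileView (suc N))) (m<n⇒m<1+n (n<1+n N))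

outerCorner-isVertex : ∀ {N k} → 1 ≤ k → k ≤ N → IsVertex N (outerCorner k)
outerCorner-isVertex {k = k} 1≤k k≤N = k , (1≤k , k≤N) , corner (isOdd k)
  where
  corner : ∀ b → Σ Side λ s → sideStart (ll k) s ≡ (if b then sideStart (ll k) right else sideStart (ll k) left)
  corner true  = right , refl
  corner false = left , refl

ll-isVertex : ∀ {N k} → 1 ≤ N → 1 ≤ k → k ≤ suc (suc N) → IsVertex N (ll k)
ll-isVertex {N} {k} 1≤N 1≤k k≤2+N with k ≤? N
... | yes k≤N = k , (1≤k , k≤N) , inner-corners (tileView′ k 1≤k) 0 z≤n
... | no k≰N = N , (1≤N , ≤-refl) , subst (λ k → Σ Side λ s → sideStart (ll N) s ≡ ll k)
                                            (m∸n+n≡m (<⇒≤ (≰⇒> k≰N)))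
                                           (inner-corners (tileView′ N 1≤N) (k ∸ N) (∸-≤ k≤2+N))
  where
  ∸-≤ : k ≤ suc (suc N) → k ∸ N ≤ 2
  ∸-≤ k≤ = subst (k ∸ N ≤_) (m+n∸n≡m 2 N) (∸-monoˡ-≤ N k≤)

height : ∀ {N} → Cover N → ℕ → ℕ
height ω k = mult ω (snakeEdge (F k))

-- The multiplicities of the cover with heights a; ω(x_(N+1)) = N+1 - a_N comes from reading
-- a_(N+1) as N+1.
extend : ℕ → (ℕ → ℕ) → ℕ → ℕ
extend N a k = if does (k ≤? N) then a k else k

extend-≤ : ∀ {N} a {k} → k ≤ N → extend N a k ≡ a k
extend-≤ {N} a {k} k≤N rewrite dec-true (k ≤? N) k≤N = refl

extend-> : ∀ {N} a {k} → N < k → extend N a k ≡ k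
extend-> {N} a {k} N<k rewrite dec-false (k ≤? N) (<⇒≱ N<k) = refl

heightValue : ℕ → (ℕ → ℕ) → SnakeEdge → ℕ
heightValue N a (F k) = a k
heightValue N a (G k) = k ∸ a k
heightValue N a (X k) = extend N a k ∸ a (pred k)

record Valid (N : ℕ) (a : ℕ → ℕ) : Set where
  field
    at-zero  : a 0 ≡ 0
    bounded  : ∀ k → k ≤ N → a k ≤ k
    monotone : ∀ k → suc k ≤ N → a k ≤ a (suc k)

heightMult : ℕ → (ℕ → ℕ) → Edge → ℕ
heightMult N a e = maybe (λ s → if does (inRange? N s) then heightValue N a s else 0) 0 (classify e)

heightMult-cong : ∀ {N} (a b : ℕ → ℕ) e →
                  (∀ s → classify e ≡ just s → InRange N s → heightValue N a s ≡ heightValue N b s) →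
                  heightMult N a e ≡ heightMult N b e
heightMult-cong {N} a b e same with classify e
... | nothing = refl
... | just s with inRange? N s
...   | yes inRange = same s refl inRange
...   | no _        = refl

module CoverEquations {N} (1≤N : 1 ≤ N) (ω : Cover N) where

  private
    m : Edge → ℕ
    m = mult ω
    m̂ : SnakeEdge → ℕ
    m̂ = m ∘ snakeEdge
    a : ℕ → ℕ
    a = height ω

  vanishes : VanishesOffSnake m
  vanishes e unclassified = support ω e λ isEdge →
    case trans (sym unclassified) (proj₁ (proj₂ (isEdge-classify isEdge))) of λ ()

  out-of-range : ∀ s → ¬ InRange N s → m̂ s ≡ 0
  out-of-range s ¬inRange = support ω (snakeEdge s) (¬inRange ∘ isEdge-inRange s)

  height-0 : a 0 ≡ 0
  height-0 = vanishes (h 1 0) refl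

  outer : ∀ k → 1 ≤ k → k ≤ N → a k + m̂ (G k) ≡ k
  outer k 1≤k k≤N = begin
    a k + m̂ (G k)              ≡⟨ vertexSum-outer m vanishes (tileView′ k 1≤k) ⟨
    vertexSum m (outerCorner k) ≡⟨ balanced ω (outerCorner k) (outerCorner-isVertex 1≤k k≤N) ⟩
    label N (outerCorner k)     ≡⟨ label-outer N k 1≤k k≤N ⟩
    k                           ∎
    where open ≡-Reasoning

  inner : ∀ k → 1 ≤ k → k ≤ suc (suc N) →
          m̂ (G k) + (m̂ (X k) + (m̂ (X (pred k)) + a (pred (pred k)))) ≡ label N (ll k)
  inner k 1≤k k≤2+N = trans (sym (vertexSum-inner m vanishes (tileView′ k 1≤k)))
                      (balanced ω (ll k) (ll-isVertex 1≤N 1≤k k≤2+N))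

  height-bounded : ∀ k → k ≤ N → a k ≤ k
  height-bounded zero    _   = ≤-reflexive height-0
  height-bounded (suc k) k<N = subst (a (suc k) ≤_) (outer (suc k) (s≤s z≤n) k<N) (m≤m+n _ _)

  G-value : ∀ k → 1 ≤ k → k ≤ N → m̂ (G k) ≡ k ∸ a k
  G-value k 1≤k k≤N = trans (sym (m+n∸m≡n (a k) (m̂ (G k)))) (cong (_∸ a k) (outer k 1≤k k≤N))

  inner-inside : ∀ k → 1 ≤ k → k ≤ N → m̂ (G k) + (m̂ (X k) + (m̂ (X (pred k)) + a (pred (pred k)))) ≡ k
  inner-inside k 1≤k k≤N =
    trans (inner k 1≤k (≤-trans k≤N (≤-trans (n≤1+n N) (n≤1+n (suc N)))))
          (label-inner N k 1≤k (m≤n⇒m≤1+n k≤N))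

  X-telescopes : ∀ k → k ≤ N → m̂ (X k) + a (pred k) ≡ a k
  X-telescopes zero    _   = cong (_+ a 0) height-0
  X-telescopes (suc k) k<N = +-cancelˡ-≡ (m̂ (G (suc k))) _ _ (begin
    m̂ (G (suc k)) + (m̂ (X (suc k)) + a k)
      ≡⟨ cong (λ z → m̂ (G (suc k)) + (m̂ (X (suc k)) + z)) (X-telescopes k (<⇒≤ k<N)) ⟨
    m̂ (G (suc k)) + (m̂ (X (suc k)) + (m̂ (X k) + a (pred k)))
      ≡⟨ inner-inside (suc k) (s≤s z≤n) k<N ⟩
    suc k
      ≡⟨ outer (suc k) (s≤s z≤n) k<N ⟨
    a (suc k) + m̂ (G (suc k))
      ≡⟨ +-comm (a (suc k)) _ ⟩
    m̂ (G (suc k)) + a (suc k) ∎)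
    where open ≡-Reasoning

  last-X : m̂ (X (suc N)) + a N ≡ suc N
  last-X = begin
    m̂ (X (suc N)) + a N
      ≡⟨ cong₂ (λ g x → g + (x + (m̂ (X (suc N)) + a N))) (out-of-range (G (2 + N)) G-beyond)
                                                          (out-of-range (X (2 + N)) X-beyond) ⟨
    m̂ (G (2 + N)) + (m̂ (X (2 + N)) + (m̂ (X (suc N)) + a N))
      ≡⟨ inner (2 + N) (s≤s z≤n) ≤-refl ⟩
    label N (ll (2 + N))
      ≡⟨ label-beyond N ⟩
    suc N ∎
    where open ≡-Reasoning

  formula : ∀ s → InRange N s → m̂ s ≡ heightValue N a s
  formula (F k) _                = refl
  formula (G k) (1≤k , k≤N)      = G-value k 1≤k k≤N
  formula (X k) (1≤k , k≤1+N) with m≤n⇒m<n∨m≡n k≤1+N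
  ... | inj₁ k<1+N = trans (sym (m+n∸n≡m (m̂ (X k)) (a (pred k))))
                           (cong (_∸ a (pred k)) (trans (X-telescopes k (s≤s⁻¹ k<1+N))
                                                                          (sym (extend-≤ a (s≤s⁻¹ k<1+N)))))
  ... | inj₂ refl  = trans (sym (m+n∸n≡m (m̂ (X (suc N))) (a N)))
                     (cong (_∸ a N) (trans last-X (sym (extend-> a (n<1+n N)))))

  valid : Valid N a
  valid = record
    { at-zero  = height-0
    ; bounded  = height-bounded
    ; monotone = λ k k<N → subst (a k ≤_) (X-telescopes (suc k) k<N) (m≤n+m (a k) _)
    }

  mult≡heightMult : ∀ e → m e ≡ heightMult N a e
  mult≡heightMult e with classify e in eq
  ... | nothing = vanishes e eq
  ... | just s with inRange? N s
  ...   | yes inRange = trans (cong m (sym (snakeEdge-classify eq))) (formula s inRange)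
  ...   | no outside  = trans (cong m (sym (snakeEdge-classify eq))) (out-of-range s outside)

heightValue-cong : ∀ {N} {a b : ℕ → ℕ} → (∀ k → k ≤ N → a k ≡ b k) →
                   ∀ s → InRange N s → heightValue N a s ≡ heightValue N b s
heightValue-cong a≗b (F k) (_ , k≤N) = a≗b k k≤N
heightValue-cong a≗b (G k) (_ , k≤N) = cong (k ∸_) (a≗b k k≤N)
heightValue-cong {N} {a} {b} a≗b (X k) (_ , k≤1+N) = cong₂ _∸_ extended (a≗b (pred k) (pred-≤ k≤1+N))
  where
  pred-≤ : ∀ {k} → k ≤ suc N → pred k ≤ N
  pred-≤ {zero}  _ = z≤n
  pred-≤ {suc k} k≤ = s≤s⁻¹ k≤
  extended : extend N a k ≡ extend N b k
  extended with k ≤? N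
  ... | yes k≤N = trans (extend-≤ a k≤N) (trans (a≗b k k≤N) (sym (extend-≤ b k≤N)))
  ... | no k≰N  = trans (extend-> a (≰⇒> k≰N)) (sym (extend-> b (≰⇒> k≰N)))

height-injective : ∀ {N} (1≤N : 1 ≤ N) (ω ω′ : Cover N) → (∀ k → 1 ≤ k → k ≤ N → height ω k ≡ height ω′ k) →
                   ω ≈ᶜ ω′
height-injective {N} 1≤N ω ω′ same e = begin
  mult ω e                     ≡⟨ CoverEquations.mult≡heightMult 1≤N ω e ⟩
  heightMult N (height ω) e    ≡⟨ heightMult-cong (height ω) (height ω′) e (λ s _ → heightValue-cong same′ s) ⟩
  heightMult N (height ω′) e   ≡⟨ CoverEquations.mult≡heightMult 1≤N ω′ e ⟨
  mult ω′ e                    ∎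
  where
  open ≡-Reasoning
  same′ : ∀ k → k ≤ N → height ω k ≡ height ω′ k
  same′ zero    _   = trans (CoverEquations.height-0 1≤N ω) (sym (CoverEquations.height-0 1≤N ω′))
  same′ (suc k) k<N = same (suc k) (s≤s z≤n) k<N

telescope : ∀ {x y z w} → x ≤ y → y ≤ z → z ≤ w → (w ∸ z) + ((z ∸ y) + ((y ∸ x) + x)) ≡ w
telescope {x} {y} {z} {w} x≤y y≤z z≤w = begin
  (w ∸ z) + ((z ∸ y) + ((y ∸ x) + x))  ≡⟨ cong (λ t → (w ∸ z) + ((z ∸ y) + t)) (m∸n+n≡m x≤y) ⟩
  (w ∸ z) + ((z ∸ y) + y)              ≡⟨ cong ((w ∸ z) +_) (m∸n+n≡m y≤z) ⟩
  (w ∸ z) + z                          ≡⟨ m∸n+n≡m z≤w ⟩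
  w                                    ∎
  where open ≡-Reasoning

module HeightsCover {N} (1≤N : 1 ≤ N) (a : ℕ → ℕ) (valid : Valid N a) where

  open Valid valid

  M : Edge → ℕ
  M = heightMult N a

  private
    M̂ : SnakeEdge → ℕ
    M̂ = M ∘ snakeEdge
    â : ℕ → ℕ
    â = extend N a

  M-inRange : ∀ s → InRange N s → M̂ s ≡ heightValue N a s
  M-inRange s inRange rewrite classify-snakeEdge s (index-inRange s inRange) | dec-true (inRange? N s) inRange = refl

  M-outside : ∀ s → ¬ InRange N s → M̂ s ≡ 0
  M-outside (F zero)    _ = refl
  M-outside (G zero)    _ = refl
  M-outside (X zero)    _ = refl
  M-outside s@(F (suc _)) ¬inRange rewrite classify-snakeEdge s (s≤s z≤n) | dec-false (inRange? N s) ¬inRange = refl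
  M-outside s@(G (suc _)) ¬inRange rewrite classify-snakeEdge s (s≤s z≤n) | dec-false (inRange? N s) ¬inRange = refl
  M-outside s@(X (suc _)) ¬inRange rewrite classify-snakeEdge s (s≤s z≤n) | dec-false (inRange? N s) ¬inRange = refl

  M-vanishes : VanishesOffSnake M
  M-vanishes e unclassified rewrite unclassified = refl

  M-support : ∀ e → ¬ IsEdge N e → M e ≡ 0
  M-support e ¬isEdge with classify e in eq
  ... | nothing = refl
  ... | just s with inRange? N s
  ...   | yes inRange = contradiction (subst (IsEdge N) (snakeEdge-classify eq) (inRange-isEdge 1≤N s inRange)) ¬isEdge
  ...   | no _        = refl

  extended-monotone : ∀ k → k ≤ N → â k ≤ â (suc k)
  extended-monotone k k≤N with m≤n⇒m<n∨m≡n k≤N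
  ... | inj₁ k<N = subst₂ _≤_ (sym (extend-≤ a k≤N)) (sym (extend-≤ a k<N)) (monotone k k<N)
  ... | inj₂ refl = subst₂ _≤_ (sym (extend-≤ a k≤N)) (sym (extend-> a (n<1+n N)))
                    (m≤n⇒m≤1+n (bounded N ≤-refl))

  extended-monotone-pred : ∀ k → k ≤ suc N → â (pred k) ≤ â k
  extended-monotone-pred zero    _     = ≤-refl
  extended-monotone-pred (suc k) k<1+N = extended-monotone k (s≤s⁻¹ k<1+N)

  extended-bounded : ∀ k → k ≤ suc N → â k ≤ k
  extended-bounded k k≤1+N with k ≤? N
  ... | yes k≤N = subst (_≤ k) (sym (extend-≤ a k≤N)) (bounded k k≤N)
  ... | no k≰N  = ≤-reflexive (extend-> a (≰⇒> k≰N))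

  extended-0 : â 0 ≡ 0
  extended-0 = trans (extend-≤ {N} a z≤n) at-zero

  M-F : ∀ k → k ≤ N → M̂ (F k) ≡ â k
  M-F zero    _   = sym extended-0
  M-F (suc k) k<N = trans (M-inRange (F (suc k)) (s≤s z≤n , k<N)) (sym (extend-≤ a k<N))

  M-G : ∀ k → k ≤ suc N → M̂ (G k) ≡ k ∸ â k
  M-G zero    _ = sym (0∸n≡0 (â 0))
  M-G (suc k) k≤N with suc k ≤? N
  ... | yes k<N = trans (M-inRange (G (suc k)) (s≤s z≤n , k<N)) (cong (suc k ∸_) (sym (extend-≤ a k<N)))
  ... | no k≮N  = trans (M-outside (G (suc k)) (k≮N ∘ proj₂))
                  (sym (trans (cong (suc k ∸_) (extend-> a (≰⇒> k≮N))) (n∸n≡0 (suc k))))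

  M-X : ∀ k → k ≤ suc N → M̂ (X k) ≡ â k ∸ â (pred k)
  M-X zero    _     = sym (n∸n≡0 (â 0))
  M-X (suc k) k<1+N = trans (M-inRange (X (suc k)) (s≤s z≤n , k<1+N))
                      (cong (â (suc k) ∸_) (sym (extend-≤ a (s≤s⁻¹ k<1+N))))

  inner-telescopes : ∀ k → 1 ≤ k → k ≤ suc N → vertexSum M (ll k) ≡ k
  inner-telescopes k 1≤k k≤1+N = begin
    vertexSum M (ll k)
      ≡⟨ vertexSum-inner M M-vanishes (tileView′ k 1≤k) ⟩
    M̂ (G k) + (M̂ (X k) + (M̂ (X (pred k)) + M̂ (F (pred (pred k)))))
      ≡⟨ cong₂ _+_ (M-G k k≤1+N) (cong₂ _+_ (M-X k k≤1+N)
                                  (cong₂ _+_ (M-X (pred k) k-1≤1+N) (M-F (pred (pred k)) k-2≤N))) ⟩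
    (k ∸ â k) + ((â k ∸ â (pred k)) + ((â (pred k) ∸ â (pred (pred k))) + â (pred (pred k))))
      ≡⟨ telescope (extended-monotone-pred (pred k) k-1≤1+N) (extended-monotone-pred k k≤1+N)
                   (extended-bounded k k≤1+N) ⟩
    k ∎
    where
    open ≡-Reasoning
    k-1≤1+N : pred k ≤ suc N
    k-1≤1+N = ≤-trans pred[n]≤n k≤1+N
    k-2≤N : pred (pred k) ≤ N
    k-2≤N = ≤-trans pred[n]≤n (pred-mono-≤ k≤1+N)

  last-inner : vertexSum M (ll (2 + N)) ≡ label N (ll (2 + N))
  last-inner = begin
    vertexSum M (ll (2 + N))
      ≡⟨ vertexSum-inner M M-vanishes (tileView (suc N)) ⟩
    M̂ (G (2 + N)) + (M̂ (X (2 + N)) + (M̂ (X (suc N)) + M̂ (F N)))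
      ≡⟨ cong₂ (λ g x → g + (x + (M̂ (X (suc N)) + M̂ (F N))))
           (M-outside (G (2 + N)) G-beyond) (M-outside (X (2 + N)) X-beyond) ⟩
    M̂ (X (suc N)) + M̂ (F N)
      ≡⟨ cong₂ _+_ (M-X (suc N) ≤-refl) (M-F N ≤-refl) ⟩
    (â (suc N) ∸ â N) + â N
      ≡⟨ m∸n+n≡m (extended-monotone N ≤-refl) ⟩
    â (suc N)
      ≡⟨ extend-> a (n<1+n N) ⟩
    suc N
      ≡⟨ label-beyond N ⟨
    label N (ll (2 + N)) ∎
    where open ≡-Reasoning

  M-balanced : ∀ p → IsVertex N p → vertexSum M p ≡ label N p
  M-balanced _ (k , (1≤k , k≤N) , s , refl) with tile-corners (tileView′ k 1≤k) s
  ... | inj₁ eq rewrite eq = begin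
    vertexSum M (outerCorner k)  ≡⟨ vertexSum-outer M M-vanishes (tileView′ k 1≤k) ⟩
    M̂ (F k) + M̂ (G k)            ≡⟨ cong₂ _+_ (M-inRange (F k) (1≤k , k≤N)) (M-inRange (G k) (1≤k , k≤N)) ⟩
    a k + (k ∸ a k)              ≡⟨ m+[n∸m]≡n (bounded k k≤N) ⟩
    k                            ≡⟨ label-outer N k 1≤k k≤N ⟨
    label N (outerCorner k)      ∎
    where open ≡-Reasoning
  ... | inj₂ (d , d≤2 , eq) rewrite eq with d + k ≤? suc N
  ...   | yes k′≤1+N = trans (inner-telescopes (d + k) (≤-trans 1≤k (m≤n+m k d)) k′≤1+N)
                             (sym (label-inner N (d + k) (≤-trans 1≤k (m≤n+m k d)) k′≤1+N))
  ...   | no k′≰1+N  = subst (λ k′ → vertexSum M (ll k′) ≡ label N (ll k′)) (sym k′≡2+N) last-inner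
    where
    k′≡2+N : d + k ≡ 2 + N
    k′≡2+N = ≤-antisym (+-mono-≤ d≤2 k≤N) (≰⇒> k′≰1+N)

  cover : Cover N
  cover = record { mult = M ; support = M-support ; balanced = M-balanced }

  height-cover : ∀ k → k ≤ N → height cover k ≡ a k
  height-cover k k≤N = trans (M-F k k≤N) (extend-≤ a k≤N)

-- The colouring and face twists

checkerboard : Point → Bool
checkerboard (x , y) = isOdd (x + y)

-- The sides of T_k that a positive twist at T_k increments, i.e. its even sides.
raised : Role → Bool
raised f-side  = true
raised g-side  = false
raised x-side  = true
raised x⁺-side = false

private
  b≢not-b : ∀ {b} → b ≢ not b
  b≢not-b {true}  ()
  b≢not-b {false} ()

  isOdd-double : ∀ j → isOdd (j + j) ≡ false
  isOdd-double zero    = refl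
  isOdd-double (suc j) rewrite +-suc j j | isOdd-double j = refl

  isOdd-double+1 : ∀ j → isOdd (j + suc j) ≡ true
  isOdd-double+1 j rewrite +-suc j j | isOdd-double j = refl

checkerboard-ends : ∀ e → checkerboard (proj₁ (ends e)) ≢ checkerboard (proj₂ (ends e))
checkerboard-ends (h x y) eq = b≢not-b eq
checkerboard-ends (v x y) eq = b≢not-b (trans eq (cong isOdd (+-suc x y)))

checkerboard-corner : ∀ {k} → TileView k → ∀ s → checkerboard (sideStart (ll k) s) ≡ raised (sideRole (isOdd k) s)
checkerboard-corner (odd j refl) s rewrite ll-oddTile j | isOdd-oddTile j = corner s
  where
  corner : ∀ s → checkerboard (sideStart (j , j) s) ≡ raised (sideRole true s)
  corner bottom = isOdd-double j
  corner right  = cong not (isOdd-double j)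
  corner top    = trans (cong (not ∘ isOdd) (+-suc j j)) (cong (not ∘ not) (isOdd-double j))
  corner left   = isOdd-double+1 j
checkerboard-corner (even j refl) s rewrite ll-evenTile j | isOdd-oddTile j = corner s
  where
  corner : ∀ s → checkerboard (sideStart (j , suc j) s) ≡ raised (sideRole false s)
  corner bottom = isOdd-double+1 j
  corner right  = cong not (isOdd-double+1 j)
  corner top    = trans (cong (not ∘ isOdd) (+-suc j (suc j))) (cong (not ∘ not) (isOdd-double+1 j))
  corner left   = trans (cong isOdd (trans (+-suc j (suc j)) (cong suc (+-suc j j)))) (cong (not ∘ not) (isOdd-double j))

-- The snake is connected, so a proper colouring agrees with the checkerboard colouring or with
-- its opposite, and the normalisation excludes the opposite.
module Colouring {N} (1≤N : 1 ≤ N) (c : Point → Bool)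
                 (proper : ProperColouring N c) (normalised : Normalised N c) where

  private
    Agrees : Point → Set
    Agrees p = c p ≡ checkerboard p

    across : ∀ e → IsEdge N e → Agrees (proj₁ (ends e)) → Agrees (proj₂ (ends e))
    across e isEdge agrees = trans (¬-not (proper e isEdge ∘ sym))
                                   (trans (cong not agrees) (sym (¬-not (checkerboard-ends e ∘ sym))))

    across⁻¹ : ∀ e → IsEdge N e → Agrees (proj₂ (ends e)) → Agrees (proj₁ (ends e))
    across⁻¹ e isEdge agrees = trans (¬-not (proper e isEdge))
                                     (trans (cong not agrees) (sym (¬-not (checkerboard-ends e))))

    TileAgrees : ℕ → Set
    TileAgrees k = ∀ s → Agrees (sideStart (ll k) s)

    tile-agrees : ∀ k → 1 ≤ k → k ≤ N → ∀ s → Agrees (sideStart (ll k) s) → TileAgrees k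
    tile-agrees k 1≤k k≤N s agrees = from-bottom (to-bottom s agrees)
      where
      side : ∀ s → IsEdge N (sideEdge (ll k) s)
      side s = k , (1≤k , k≤N) , s , refl
      to-bottom : ∀ s → Agrees (sideStart (ll k) s) → Agrees (sideStart (ll k) bottom)
      to-bottom bottom agrees = agrees
      to-bottom right  agrees = across⁻¹ _ (side bottom) agrees
      to-bottom top    agrees = across⁻¹ _ (side bottom) (across⁻¹ _ (side right) agrees)
      to-bottom left   agrees = across⁻¹ _ (side left) agrees
      from-bottom : Agrees (sideStart (ll k) bottom) → TileAgrees k
      from-bottom agrees bottom = agrees
      from-bottom agrees right  = across _ (side bottom) agrees
      from-bottom agrees top    = across _ (side right) (across _ (side bottom) agrees)
      from-bottom agrees left   = across _ (side left) agrees

    last-tile-agrees : TileAgrees N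
    last-tile-agrees = tile-agrees N 1≤N ≤-refl (roleSide (isOdd N) f-side)
      (trans (f-side-black (isOdd N) normalised) (sym (trans (checkerboard-corner (tileView′ N 1≤N) _)
                                                      (cong raised (sideRole-roleSide (isOdd N) f-side)))))
      where
      f-side-black : ∀ b → (if b then c (sideStart (ll N) right) ≡ true else c (sideStart (ll N) top) ≡ true) →
                     c (sideStart (ll N) (roleSide b f-side)) ≡ true
      f-side-black true  black = black
      f-side-black false black = black

    all-tiles-agree : ∀ d k → 1 ≤ k → d + k ≡ N → TileAgrees k
    all-tiles-agree zero    k 1≤k refl = last-tile-agrees
    all-tiles-agree (suc d) k 1≤k d+k≡N with inner-corners (tileView′ k 1≤k) 1 (s≤s z≤n)
    ... | s , s≡next = tile-agrees k 1≤k (subst (k ≤_) d+k≡N (m≤n+m k (suc d))) s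
      (subst Agrees (sym s≡next) (all-tiles-agree d (suc k) (s≤s z≤n) (trans (+-suc d k) d+k≡N) bottom))

  colour : ∀ k → 1 ≤ k → k ≤ N → ∀ s → c (sideStart (ll k) s) ≡ raised (sideRole (isOdd k) s)
  colour k 1≤k k≤N s = trans (all-tiles-agree (N ∸ k) k 1≤k (m∸n+n≡m k≤N) s)
                       (checkerboard-corner (tileView′ k 1≤k) s)

roleEdge-F : ∀ {k p} r → roleEdge k r ≡ F p → p ≡ k
roleEdge-F f-side refl = refl
roleEdge-F g-side ()
roleEdge-F x-side ()
roleEdge-F x⁺-side ()

F-not-side : ∀ {k} → TileView k → ∀ p → p ≢ k → ∀ s → sideEdge (ll k) s ≢ snakeEdge (F p)
F-not-side {k} view p p≢k s eq with classify-side view s | p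
... | classified | zero    = case-nothing (trans (sym classified) (cong classify eq))
  where
  case-nothing : ∀ {s} → just s ≢ nothing
  case-nothing ()
... | classified | suc p′  = p≢k (roleEdge-F (sideRole (isOdd k) s) (just-injective
                               (trans (sym classified) (trans (cong classify eq) (classify-snakeEdge (F (suc p′)) (s≤s z≤n))))))

module TwistHeights {N} (1≤N : 1 ≤ N) (c : Point → Bool)
                    (proper : ProperColouring N c) (normalised : Normalised N c) where

  open Colouring 1≤N c proper normalised

  HeightStep : Cover N → Cover N → ℕ → Set
  HeightStep ω ω′ k = height ω′ k ≡ suc (height ω k) × (∀ p → p ≢ k → height ω′ p ≡ height ω p)

  twist⇒heightStep : ∀ (ω ω′ : Cover N) → PosTwist N c (mult ω) (mult ω′) →
                     Σ ℕ λ k → (1 ≤ k × k ≤ N) × HeightStep ω ω′ k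
  twist⇒heightStep ω ω′ twist = face , isFace , raised-f , untouched
    where
    open PosTwist twist
    view : TileView face
    view = tileView′ face (proj₁ isFace)
    f-side-edge : sideEdge (ll face) (roleSide (isOdd face) f-side) ≡ snakeEdge (F face)
    f-side-edge = sideEdge-roleSide view f-side
    f-side-even : EvenSide c face (roleSide (isOdd face) f-side)
    f-side-even = trans (colour face (proj₁ isFace) (proj₂ isFace) _) (cong raised (sideRole-roleSide (isOdd face) f-side))
    raised-f : height ω′ face ≡ suc (height ω face)
    raised-f = subst (λ e → mult ω′ e ≡ suc (mult ω e)) f-side-edge (onEven _ f-side-even)
    untouched : ∀ p → p ≢ face → height ω′ p ≡ height ω p
    untouched p p≢k = offFace (snakeEdge (F p)) (F-not-side view p p≢k)

  module _ (ω ω′ : Cover N) (k : ℕ) (1≤k : 1 ≤ k) (k≤N : k ≤ N)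
           (a′k : height ω′ k ≡ suc (height ω k)) (a′p : ∀ p → p ≢ k → height ω′ p ≡ height ω p) where

    private
      a a′ : ℕ → ℕ
      a  = height ω
      a′ = height ω′
      module V  = Valid (CoverEquations.valid 1≤N ω)
      module V′ = Valid (CoverEquations.valid 1≤N ω′)

      view : TileView k
      view = tileView′ k 1≤k

      value : Cover N → Role → ℕ
      value ω r = heightValue N (height ω) (roleEdge k r)

      mult-side : ∀ ω s → mult ω (sideEdge (ll k) s) ≡ value ω (sideRole (isOdd k) s)
      mult-side ω s = trans (cong (mult ω) (sym (snakeEdge-classify (classify-side view s))))
                            (CoverEquations.formula 1≤N ω _ (roleEdge-inRange 1≤k k≤N (sideRole (isOdd k) s)))

      k-1≢k : pred k ≢ k
      k-1≢k eq = <⇒≢ (pred< 1≤k) eq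
        where
        pred< : ∀ {k} → 1 ≤ k → pred k < k
        pred< {suc k} _ = n<1+n k

      1+k≢k : suc k ≢ k
      1+k≢k eq = <⇒≢ (n<1+n k) (sym eq)

      extend-next : extend N a′ (suc k) ≡ extend N a (suc k)
      extend-next with suc k ≤? N
      ... | yes k<N = trans (extend-≤ a′ k<N) (trans (a′p (suc k) 1+k≢k) (sym (extend-≤ a k<N)))
      ... | no k≮N  = trans (extend-> a′ (≰⇒> k≮N)) (sym (extend-> a (≰⇒> k≮N)))

      next-above : suc (a k) ≤ extend N a (suc k)
      next-above with suc k ≤? N
      ... | yes k<N = subst₂ _≤_ a′k (trans (a′p (suc k) 1+k≢k) (sym (extend-≤ a k<N))) (V′.monotone k k<N)
      ... | no k≮N  = subst (suc (a k) ≤_) (sym (extend-> a (≰⇒> k≮N))) (s≤s (V.bounded k k≤N))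

      a-pred≤a : ∀ k → 1 ≤ k → k ≤ N → a (pred k) ≤ a k
      a-pred≤a (suc k) _ k<N = V.monotone k k<N


    raised-values : ∀ r → raised r ≡ true → value ω′ r ≡ suc (value ω r)
    raised-values f-side  _ = a′k
    raised-values x-side  _ = begin
      extend N a′ k ∸ a′ (pred k)     ≡⟨ cong₂ _∸_ (trans (extend-≤ a′ k≤N) a′k) (a′p (pred k) k-1≢k) ⟩
      suc (a k) ∸ a (pred k)          ≡⟨ +-∸-assoc 1 (a-pred≤a k 1≤k k≤N) ⟩
      suc (a k ∸ a (pred k))          ≡⟨ cong (λ x → suc (x ∸ a (pred k))) (extend-≤ a k≤N) ⟨
      suc (extend N a k ∸ a (pred k)) ∎
      where open ≡-Reasoning

    lowered-values : ∀ r → raised r ≡ false → 1 ≤ value ω r × value ω′ r ≡ value ω r ∸ 1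
    lowered-values g-side  _ = m<n⇒0<n∸m (subst (_≤ k) a′k (V′.bounded k k≤N)) ,
                               trans (cong (k ∸_) a′k) (sym (pred[m∸n]≡m∸[1+n] k (a k)))
    lowered-values x⁺-side _ = m<n⇒0<n∸m next-above ,
                               trans (cong₂ _∸_ extend-next a′k) (sym (pred[m∸n]≡m∸[1+n] (extend N a (suc k)) (a k)))

    unrelated-values : ∀ s → InRange N s → (∀ r → s ≢ roleEdge k r) → heightValue N a′ s ≡ heightValue N a s
    unrelated-values (F p) _ ≢side = a′p p (λ { refl → ≢side f-side refl })
    unrelated-values (G p) _ ≢side = cong (p ∸_) (a′p p (λ { refl → ≢side g-side refl }))
    unrelated-values (X p) (1≤p , _) ≢side = cong₂ _∸_ same-extend (a′p (pred p) p-1≢k)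
      where
      p≢k : p ≢ k
      p≢k refl = ≢side x-side refl
      p-1≢k : pred p ≢ k
      p-1≢k eq = ≢side x⁺-side (cong X (trans (sym (suc-pred p ⦃ >-nonZero 1≤p ⦄)) (cong suc eq)))
      same-extend : extend N a′ p ≡ extend N a p
      same-extend with p ≤? N
      ... | yes p≤N = trans (extend-≤ a′ p≤N) (trans (a′p p p≢k) (sym (extend-≤ a p≤N)))
      ... | no p≰N  = trans (extend-> a′ (≰⇒> p≰N)) (sym (extend-> a (≰⇒> p≰N)))

    heightStep⇒twist : PosTwist N c (mult ω) (mult ω′)
    heightStep⇒twist = record
      { face     = k
      ; isFace   = 1≤k , k≤N
      ; positive = λ s odd-side → subst (1 ≤_) (sym (mult-side ω s)) (proj₁ (lowered-values _ (lowered s odd-side)))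
      ; onOdd    = λ s odd-side → trans (mult-side ω′ s)
                     (trans (proj₂ (lowered-values _ (lowered s odd-side))) (cong (_∸ 1) (sym (mult-side ω s))))
      ; onEven   = λ s even-side → trans (mult-side ω′ s)
                     (trans (raised-values _ (raised′ s even-side)) (cong suc (sym (mult-side ω s))))
      ; offFace  = off-face
      }
      where
      lowered : ∀ s → OddSide c k s → raised (sideRole (isOdd k) s) ≡ false
      lowered s odd-side = trans (sym (colour k 1≤k k≤N s)) odd-side
      raised′ : ∀ s → EvenSide c k s → raised (sideRole (isOdd k) s) ≡ true
      raised′ s even-side = trans (sym (colour k 1≤k k≤N s)) even-side
      off-face : ∀ e → (∀ s → sideEdge (ll k) s ≢ e) → mult ω′ e ≡ mult ω e
      off-face e ≢sides = begin
        mult ω′ e               ≡⟨ CoverEquations.mult≡heightMult 1≤N ω′ e ⟩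
        heightMult N a′ e       ≡⟨ heightMult-cong a′ a e (λ s eq inRange → unrelated-values s inRange (not-side eq)) ⟩
        heightMult N a e        ≡⟨ CoverEquations.mult≡heightMult 1≤N ω e ⟨
        mult ω e                ∎
        where
        open ≡-Reasoning
        not-side : ∀ {s} → classify e ≡ just s → ∀ r → s ≢ roleEdge k r
        not-side eq r refl = ≢sides (roleSide (isOdd k) r) (trans (sideEdge-roleSide view r) (snakeEdge-classify eq))

-- Covers as Lehmer codes

fEdge≡snakeEdge : ∀ k → 1 ≤ k → fEdge k ≡ snakeEdge (F k)
fEdge≡snakeEdge k 1≤k with tileView′ k 1≤k
... | odd j refl  = trans (fEdge-oddTile j) (sym (snakeEdge-classify (classify-F-odd j)))
... | even j refl = trans (fEdge-evenTile j) (sym (snakeEdge-classify (classify-F-even j)))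

module CoverCodes {N} (1≤N : 1 ≤ N) where

  n : ℕ
  n = suc N

  codeOf≡height : ∀ (ω : Cover N) i → codeOf n ω i ≡ height ω (N ∸ toℕ i)
  codeOf≡height ω i with toℕ i <? N
  ... | yes i<N rewrite dec-true (toℕ i <? N) i<N = cong (mult ω) (fEdge≡snakeEdge (N ∸ toℕ i) (m<n⇒0<n∸m i<N))
  ... | no i≮N rewrite dec-false (toℕ i <? N) i≮N | m≤n⇒m∸n≡0 (≮⇒≥ i≮N)
    = sym (CoverEquations.height-0 1≤N ω)

  -- The code of a cover lists its heights backwards: position k holds the height a_k.
  position : ℕ → Fin n
  position k = fromℕ< (s≤s (m∸n≤m N k))

  toℕ-position : ∀ k → toℕ (position k) ≡ N ∸ k
  toℕ-position k = Fin.toℕ-fromℕ< (s≤s (m∸n≤m N k))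

  position-involutive : ∀ i → position (N ∸ toℕ i) ≡ i
  position-involutive i = Fin.toℕ-injective (trans (toℕ-position (N ∸ toℕ i)) (m∸[m∸n]≡n (Fin.toℕ≤pred[n] i)))

  position-of : ∀ i {k} → N ∸ toℕ i ≡ k → i ≡ position k
  position-of i refl = sym (position-involutive i)

  height≡codeOf : ∀ (ω : Cover N) k → k ≤ N → height ω k ≡ codeOf n ω (position k)
  height≡codeOf ω k k≤N = trans (cong (height ω) (sym (trans (cong (N ∸_) (toℕ-position k)) (m∸[m∸n]≡n k≤N))))
                                (sym (codeOf≡height ω (position k)))

  codeOf-cong : ∀ {ω ω′ : Cover N} → ω ≈ᶜ ω′ → ∀ i → codeOf n ω i ≡ codeOf n ω′ i
  codeOf-cong {ω} {ω′} ω≈ω′ i = trans (codeOf≡height ω i) (trans (ω≈ω′ _) (sym (codeOf≡height ω′ i)))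

  codeOf-injective : ∀ (ω ω′ : Cover N) → (∀ i → codeOf n ω i ≡ codeOf n ω′ i) → ω ≈ᶜ ω′
  codeOf-injective ω ω′ same = height-injective 1≤N ω ω′
    (λ k _ k≤N → trans (height≡codeOf ω k k≤N) (trans (same (position k)) (sym (height≡codeOf ω′ k k≤N))))

  heights-monotone : ∀ {a} → Valid N a → ∀ {k l} → k ≤ l → l ≤ N → a k ≤ a l
  heights-monotone valid {k} {zero} z≤n _ = ≤-refl
  heights-monotone valid {k} {suc l} k≤1+l l<N with m≤n⇒m<n∨m≡n k≤1+l
  ... | inj₁ k<1+l = ≤-trans (heights-monotone valid (s≤s⁻¹ k<1+l) (<⇒≤ l<N)) (Valid.monotone valid l l<N)
  ... | inj₂ refl  = ≤-refl

  codeOf-antitone : ∀ ω → Antitone (codeOf n ω)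
  codeOf-antitone ω i j i<j = subst₂ _≤_ (sym (codeOf≡height ω j)) (sym (codeOf≡height ω i))
    (heights-monotone (CoverEquations.valid 1≤N ω) (∸-monoʳ-≤ N (<⇒≤ i<j)) (m∸n≤m N (toℕ i)))

  codeOf-bounded : ∀ ω → CodeBounded (codeOf n ω)
  codeOf-bounded ω i = subst (_≤ N ∸ toℕ i) (sym (codeOf≡height ω i))
    (Valid.bounded (CoverEquations.valid 1≤N ω) (N ∸ toℕ i) (m∸n≤m N (toℕ i)))

  module _ (c : Fin n → ℕ) (antitone : Antitone c) (bounded : CodeBounded c) where

    private
      a : ℕ → ℕ
      a k = c (position k)

      a≤k : ∀ k → k ≤ N → a k ≤ k
      a≤k k k≤N = subst (a k ≤_) (trans (cong (N ∸_) (toℕ-position k)) (m∸[m∸n]≡n k≤N)) (bounded (position k))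

      valid : Valid N a
      valid = record
        { at-zero  = n≤0⇒n≡0 (a≤k 0 z≤n)
        ; bounded  = a≤k
        ; monotone = λ k k<N → antitone (position (suc k)) (position k)
                                 (subst₂ _<_ (sym (toℕ-position (suc k))) (sym (toℕ-position k)) (∸-monoʳ-< (n<1+n k) k<N))
        }

    coverOf : Cover N
    coverOf = HeightsCover.cover 1≤N a valid

    codeOf-coverOf : ∀ i → codeOf n coverOf i ≡ c i
    codeOf-coverOf i = begin
      codeOf n coverOf i                ≡⟨ codeOf≡height coverOf i ⟩
      height coverOf (N ∸ toℕ i)        ≡⟨ HeightsCover.height-cover 1≤N a valid
                                        (N ∸ toℕ i) (m∸n≤m N (toℕ i)) ⟩
      c (position (N ∸ toℕ i))          ≡⟨ cong c (position-involutive i) ⟩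
      c i                               ∎
      where open ≡-Reasoning

module TwistOrder {N} (1≤N : 1 ≤ N) (c : Point → Bool)
                  (proper : ProperColouring N c) (normalised : Normalised N c) where

  open CoverCodes 1≤N
  open TwistHeights 1≤N c proper normalised

  Twist : Cover N → Cover N → Set
  Twist ω ω′ = PosTwist N c (mult ω) (mult ω′)

  twist⇒unitStep : ∀ ω ω′ → Twist ω ω′ → ∃ λ i → UnitStep (codeOf n ω) (codeOf n ω′) i
  twist⇒unitStep ω ω′ twist with twist⇒heightStep ω ω′ twist
  ... | k , (1≤k , k≤N) , raised , same = position k ,
    trans (sym (height≡codeOf ω′ k k≤N)) (trans raised (cong suc (height≡codeOf ω k k≤N))) ,
    λ i i≢k → trans (codeOf≡height ω′ i) (trans (same (N ∸ toℕ i) (i≢k ∘ position-of i)) (sym (codeOf≡height ω i)))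

  unitStep⇒twist : ∀ ω ω′ i → UnitStep (codeOf n ω) (codeOf n ω′) i → Twist ω ω′
  unitStep⇒twist ω ω′ i (raised , same) = heightStep⇒twist ω ω′ k 1≤k (m∸n≤m N (toℕ i)) raised′ same′
    where
    k : ℕ
    k = N ∸ toℕ i
    1≤k : 1 ≤ k
    1≤k = ≤-trans (s≤s z≤n) (subst (_≤ k) raised (codeOf-bounded ω′ i))
    raised′ : height ω′ k ≡ suc (height ω k)
    raised′ = trans (sym (codeOf≡height ω′ i)) (trans raised (cong suc (codeOf≡height ω i)))
    same′ : ∀ p → p ≢ k → height ω′ p ≡ height ω p
    same′ p p≢k with p ≤? N
    ... | yes p≤N = trans (height≡codeOf ω′ p p≤N) (trans (same (position p) position≢i)
                    (sym (height≡codeOf ω p p≤N)))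
      where
      position≢i : position p ≢ i
      position≢i refl = p≢k (sym (trans (cong (N ∸_) (toℕ-position p)) (m∸[m∸n]≡n p≤N)))
    ... | no p≰N  = trans (CoverEquations.out-of-range 1≤N ω′ (F p) (p≰N ∘ proj₂))
                          (sym (CoverEquations.out-of-range 1≤N ω (F p) (p≰N ∘ proj₂)))

  chain-codes : ∀ {ω ω′ r} → TwistChain N c ω ω′ r →
                (∀ i → codeOf n ω i ≤ codeOf n ω′ i) × sum (codeOf n ω′) ≡ r + sum (codeOf n ω)
  chain-codes {ω} {ω′} (done ω≈ω′) = ≤-reflexive ∘ same , sym (sum-cong-≗ same)
    where
    same : ∀ i → codeOf n ω i ≡ codeOf n ω′ i
    same = codeOf-cong {ω} {ω′} ω≈ω′
  chain-codes {ω} {ω′} (step {ρ = ρ} chain twist) with chain-codes chain | twist⇒unitStep ρ ω′ twist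
  ... | ω≤ρ , sum-ρ | i , unit = (λ j → ≤-trans (ω≤ρ j) (unitStep-≤ unit j)) ,
                                trans (sum-unitStep unit) (cong suc sum-ρ)

  -- Lowering the last position where the codes differ keeps the code antitone.
  lower-cover : ∀ ω ω′ → (∀ i → codeOf n ω i ≤ codeOf n ω′ i) → (∃ λ i → codeOf n ω i < codeOf n ω′ i) →
                Σ (Cover N) λ ω″ → Σ (Fin n) λ i →
                  codeOf n ω i < codeOf n ω′ i × UnitStep (codeOf n ω″) (codeOf n ω′) i × Twist ω″ ω′
  lower-cover ω ω′ ω≤ω′ strict = ω″ , i , ci<c′i , unit″ , unitStep⇒twist ω″ ω′ i unit″
    where
    cω cω′ : Fin n → ℕ
    cω  = codeOf n ω
    cω′ = codeOf n ω′
    last-strict : ∃ λ i → cω i < cω′ i × ∀ l → cω l < cω′ l → n ∸ toℕ i ≤ n ∸ toℕ l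
    last-strict = argmin (λ j → cω j <? cω′ j) (λ j → n ∸ toℕ j) strict
    i : Fin n
    i = proj₁ last-strict
    ci<c′i : cω i < cω′ i
    ci<c′i = proj₁ (proj₂ last-strict)
    i-last : ∀ l → cω l < cω′ l → toℕ l ≤ toℕ i
    i-last l cl<c′l = ∸-cancelʳ-≤ (<⇒≤ (Fin.toℕ<n l)) (proj₂ (proj₂ last-strict) l cl<c′l)
    after-i : ∀ l → i <ᶠ l → cω′ l ≡ cω l
    after-i l i<l = ≤-antisym (≮⇒≥ λ cl<c′l → <⇒≱ i<l (i-last l cl<c′l)) (ω≤ω′ l)
    c″ : Fin n → ℕ
    c″ = updateAt cω′ i pred
    unit : UnitStep c″ cω′ i
    unit = unitStep-pred cω′ i (≤-<-trans z≤n ci<c′i)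
    c″-antitone : Antitone c″
    c″-antitone j l j<l with j Fin.≟ i | l Fin.≟ i
    ... | yes refl | yes refl = contradiction j<l (<-irrefl refl)
    ... | no j≢i   | yes refl = ≤-trans (unitStep-≤ unit l)
                                          (≤-trans (codeOf-antitone ω′ j l j<l) (≤-reflexive (proj₂ unit j j≢i)))
    ... | yes refl | no l≢i   = subst₂ _≤_ (proj₂ unit l l≢i) refl (begin
      cω′ l       ≡⟨ after-i l j<l ⟩
      cω l        ≤⟨ codeOf-antitone ω j l j<l ⟩
      cω j        ≤⟨ s≤s⁻¹ (subst (cω j <_) (proj₁ unit) ci<c′i) ⟩
      c″ j        ∎)
      where open ≤-Reasoning
    ... | no j≢i   | no l≢i   = subst₂ _≤_ (proj₂ unit l l≢i) (proj₂ unit j j≢i) (codeOf-antitone ω′ j l j<l)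
    c″-bounded : CodeBounded c″
    c″-bounded k = ≤-trans (unitStep-≤ unit k) (codeOf-bounded ω′ k)
    ω″ : Cover N
    ω″ = coverOf c″ c″-antitone c″-bounded
    unit″ : UnitStep (codeOf n ω″) cω′ i
    unit″ = unitStep-cong (λ k → sym (codeOf-coverOf c″ c″-antitone c″-bounded k)) (λ _ → refl) unit

  chain-of-codes : ∀ ω ω′ → (∀ i → codeOf n ω i ≤ codeOf n ω′ i) →
                   TwistChain N c ω ω′ (sum (λ i → codeOf n ω′ i ∸ codeOf n ω i))
  chain-of-codes = descent
    where open Descent (codeOf n) (TwistChain N c) Twist (λ {ω} {ω′} eq → done (codeOf-injective ω ω′ eq))
                       step lower-cover

  twistOrder⇔codes : ∀ ω ω′ → (ω ≤F⟨ c ⟩ ω′) ⇔ (∀ i → codeOf n ω i ≤ codeOf n ω′ i)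
  twistOrder⇔codes ω ω′ = mk⇔ (λ (_ , chain) → proj₁ (chain-codes chain))
                              (λ ω≤ω′ → _ , chain-of-codes ω ω′ ω≤ω′)

  bottom-cover : Cover N
  bottom-cover = coverOf (λ _ → 0) (λ _ _ _ → z≤n) (λ _ → z≤n)

  codeOf-bottom : ∀ i → codeOf n bottom-cover i ≡ 0
  codeOf-bottom = codeOf-coverOf (λ _ → 0) (λ _ _ _ → z≤n) (λ _ → z≤n)

  bottom-minimum : ∀ ω → bottom-cover ≤F⟨ c ⟩ ω
  bottom-minimum ω = Equivalence.from (twistOrder⇔codes bottom-cover ω)
                     (λ i → subst (_≤ codeOf n ω i) (sym (codeOf-bottom i)) z≤n)

  rank⇔sum : ∀ ω r → Rank N c ω r ⇔ sum (codeOf n ω) ≡ r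
  rank⇔sum ω r = mk⇔ to from
    where
    sum-zero : ∀ ω₀ → (∀ i → codeOf n ω₀ i ≡ 0) → sum (codeOf n ω₀) ≡ 0
    sum-zero ω₀ zeros = trans (sum-cong-≗ zeros) (sum-replicate-zero n)
    chain-length : ∀ {ω₀ r} → (∀ i → codeOf n ω₀ i ≡ 0) → TwistChain N c ω₀ ω r → sum (codeOf n ω) ≡ r
    chain-length {ω₀} {r} zeros chain = trans (proj₂ (chain-codes chain))
                                          (trans (cong (r +_) (sum-zero ω₀ zeros)) (+-identityʳ r))
    to : Rank N c ω r → sum (codeOf n ω) ≡ r
    to (ω₀ , minimum , chain , _) = chain-length zeros chain
      where
      zeros : ∀ i → codeOf n ω₀ i ≡ 0
      zeros i = n≤0⇒n≡0 (subst (codeOf n ω₀ i ≤_) (codeOf-bottom i)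
                                (Equivalence.to (twistOrder⇔codes ω₀ bottom-cover) (minimum bottom-cover) i))
    from : sum (codeOf n ω) ≡ r → Rank N c ω r
    from sum≡r = bottom-cover , bottom-minimum ,
                 subst (TwistChain N c bottom-cover ω) length≡r (chain-of-codes bottom-cover ω below) ,
                 λ r′ chain → ≤-reflexive (trans (sym sum≡r) (chain-length codeOf-bottom chain))
      where
      below : ∀ i → codeOf n bottom-cover i ≤ codeOf n ω i
      below i = subst (_≤ codeOf n ω i) (sym (codeOf-bottom i)) z≤n
      length≡r : sum (λ i → codeOf n ω i ∸ codeOf n bottom-cover i) ≡ r
      length≡r = trans (sum-cong-≗ (λ i → cong (codeOf n ω i ∸_) (codeOf-bottom i))) sum≡r


-- Counting up to equivalence

module _ {A : Set} {_≈_ : Rel A 0ℓ} (≈-equiv : IsEquivalence _≈_) (_≈?_ : B.Decidable _≈_)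
         {P : A → Set} (P? : ∀ x → Dec (P x)) (P-resp : ∀ {x y} → x ≈ y → P x → P y) where

  open IsEquivalence ≈-equiv renaming (refl to ≈-refl; sym to ≈-sym; trans to ≈-trans)

  private
    Representatives : List A → Set
    Representatives xs = Σ ℕ λ m → Σ (Fin m → A) λ f → (∀ i → P (f i)) × (∀ i j → f i ≈ f j → i ≡ j) ×
                         (∀ b → b ∈ xs → P b → Σ (Fin m) λ i → f i ≈ b)

    representatives : ∀ xs → Representatives xs
    representatives [] = 0 , (λ ()) , (λ ()) , (λ ()) , (λ _ ())
    representatives (x ∷ xs) with representatives xs
    ... | m , f , Pf , f-inj , covers with P? x
    ...   | no ¬Px = m , f , Pf , f-inj , λ where
              b (here refl) Pb → contradiction Pb ¬Px
              b (there b∈xs) Pb → covers b b∈xs Pb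
    ...   | yes Px with Fin.any? (λ i → f i ≈? x)
    ...     | yes (i , fi≈x) = m , f , Pf , f-inj , λ where
              b (here refl) _ → i , fi≈x
              b (there b∈xs) Pb → covers b b∈xs Pb
    ...     | no new = suc m , f′ , Pf′ , f′-inj , covers′
      where
      f′ : Fin (suc m) → A
      f′ zero    = x
      f′ (suc i) = f i
      Pf′ : ∀ i → P (f′ i)
      Pf′ zero    = Px
      Pf′ (suc i) = Pf i
      f′-inj : ∀ i j → f′ i ≈ f′ j → i ≡ j
      f′-inj zero    zero    _  = refl
      f′-inj zero    (suc j) eq = contradiction (j , ≈-sym eq) new
      f′-inj (suc i) zero    eq = contradiction (i , eq) new
      f′-inj (suc i) (suc j) eq = cong suc (f-inj i j eq)
      covers′ : ∀ b → b ∈ x ∷ xs → P b → Σ (Fin (suc m)) λ i → f′ i ≈ b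
      covers′ b (here refl)  _  = zero , ≈-refl
      covers′ b (there b∈xs) Pb = let i , fi≈b = covers b b∈xs Pb in suc i , fi≈b

  count-enumerated : (xs : List A) → (∀ a → ∃ λ b → b ∈ xs × b ≈ a) → ∃ (HasCount A _≈_ P)
  count-enumerated xs complete with representatives xs
  ... | m , f , Pf , f-inj , covers = m , f , Pf , f-inj , λ a Pa →
    let b , b∈xs , b≈a = complete a
        i , fi≈b = covers b b∈xs (P-resp (≈-sym b≈a) Pa)
    in i , ≈-trans fi≈b b≈a

module _ {A B : Set} {_≈ᴬ_ : Rel A 0ℓ} {_≈ᴮ_ : Rel B 0ℓ} (≈ᴮ-equiv : IsEquivalence _≈ᴮ_)
         {P : A → Set} {Q : B → Set}
         (g : A → B) (g-cong : ∀ {x y} → x ≈ᴬ y → g x ≈ᴮ g y) (g-injective : ∀ {x y} → g x ≈ᴮ g y → x ≈ᴬ y)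
         (P⇒Q : ∀ x → P x → Q (g x)) (lift : ∀ b → Q b → Σ A λ x → P x × g x ≈ᴮ b) where

  open IsEquivalence ≈ᴮ-equiv renaming (sym to ≈-sym; trans to ≈-trans)

  count-pullback : ∀ {m} → HasCount B _≈ᴮ_ Q m → HasCount A _≈ᴬ_ P m
  count-pullback {m} (f , Qf , f-inj , covers) = f′ , (λ i → proj₁ (proj₂ (lifted i))) , f′-inj , covers′
    where
    lifted : ∀ i → Σ A λ x → P x × g x ≈ᴮ f i
    lifted i = lift (f i) (Qf i)
    f′ : Fin m → A
    f′ i = proj₁ (lifted i)
    g-f′ : ∀ i → g (f′ i) ≈ᴮ f i
    g-f′ i = proj₂ (proj₂ (lifted i))
    f′-inj : ∀ i j → f′ i ≈ᴬ f′ j → i ≡ j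
    f′-inj i j f′i≈f′j = f-inj i j (≈-trans (≈-sym (g-f′ i)) (≈-trans (g-cong f′i≈f′j) (g-f′ j)))
    covers′ : ∀ a → P a → Σ (Fin m) λ i → f′ i ≈ᴬ a
    covers′ a Pa = let i , fi≈ga = covers (g a) (P⇒Q a Pa) in i , g-injective (≈-trans (g-f′ i) fi≈ga)

permutations : ∀ n → List (Perm n)
permutations zero    = decode (λ ()) (λ ()) ∷ []
permutations (suc n) = concatMap (λ s → map (insertHead s) (permutations n)) (allFin (suc n))

permutations-complete : ∀ {n} (σ : Perm n) → ∃ λ τ → τ ∈ permutations n × τ ≈ₚ σ
permutations-complete {zero}  σ = _ , here refl , λ ()
permutations-complete {suc n} σ with permutations-complete (removeHead σ)
... | τ , τ∈ , τ≈ =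
  insertHead σ₀ τ ,
  ∈-concatMap⁺ insertions (Any.map (λ { refl → ∈-map⁺ (insertHead σ₀) τ∈ }) (∈-allFin σ₀)) ,
  λ { zero → refl ; (suc j) → trans (cong (punchIn σ₀) (τ≈ j)) (punchIn-removeHead σ j) }
  where
  σ₀ : Fin (suc n)
  σ₀ = fun σ zero
  insertions : Fin (suc n) → List (Perm (suc n))
  insertions s = map (insertHead s) (permutations n)

≈ₚ-isEquivalence : ∀ {n} → IsEquivalence (_≈ₚ_ {n})
≈ₚ-isEquivalence = record
  { refl  = λ _ → refl
  ; sym   = λ σ≈τ i → sym (σ≈τ i)
  ; trans = λ σ≈ρ ρ≈τ i → trans (σ≈ρ i) (ρ≈τ i)
  }

_≈ₚ?_ : ∀ {n} → B.Decidable (_≈ₚ_ {n})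
σ ≈ₚ? τ = Fin.all? (λ i → fun σ i Fin.≟ fun τ i)

antitone? : ∀ {n} (c : Fin n → ℕ) → Dec (Antitone c)
antitone? c = Fin.all? (λ i → Fin.all? (λ j → (i Fin.<? j) →-dec (c j ≤? c i)))

avoids132? : ∀ {n} (σ : Perm n) → Dec (Avoids132 σ)
avoids132? σ with antitone? (code σ)
... | yes anti = yes (antitone⇒avoids132 σ anti)
... | no ¬anti = no (¬anti ∘ avoids132⇒antitone σ)

avoids132-resp : ∀ {n} (σ τ : Perm n) → σ ≈ₚ τ → Avoids132 σ → Avoids132 τ
avoids132-resp σ τ σ≈τ avoids (j , k , l , j<k , k<l , τj<τl , τl<τk) =
  avoids (j , k , l , j<k , k<l , subst₂ _<ᶠ_ (sym (σ≈τ j)) (sym (σ≈τ l)) τj<τl ,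
                                  subst₂ _<ᶠ_ (sym (σ≈τ l)) (sym (σ≈τ k)) τl<τk)

inv-resp : ∀ {n} (σ τ : Perm n) → σ ≈ₚ τ → inv σ ≡ inv τ
inv-resp σ τ σ≈τ = trans (inv≡sum-code σ) (trans (sum-cong-≗ (code-cong σ τ σ≈τ)) (sym (inv≡sum-code τ)))

count-132-avoiding : ∀ n k → ∃ (HasCount (Perm n) _≈ₚ_ (λ σ → Avoids132 σ × inv σ ≡ k))
count-132-avoiding n k =
  count-enumerated (≈ₚ-isEquivalence {n}) (_≈ₚ?_ {n}) (λ σ → avoids132? σ ×-dec (inv σ ≟ k))
    (λ {σ} {τ} σ≈τ (avoids , inv≡k) → avoids132-resp σ τ σ≈τ avoids , trans (sym (inv-resp σ τ σ≈τ)) inv≡k)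
    (permutations n) permutations-complete

module Bijection {N} (1≤N : 1 ≤ N) where

  open CoverCodes 1≤N

  φ : Cover N → Perm n
  φ ω = decode (codeOf n ω) (codeOf-bounded ω)

  code-φ : ∀ ω i → code (φ ω) i ≡ codeOf n ω i
  code-φ ω = code-decode (codeOf n ω) (codeOf-bounded ω)

  lehmer-φ : ∀ ω i → lehmer (φ ω) i ≡ codeOf n ω i
  lehmer-φ ω i = trans (lehmer≡code (φ ω) i) (code-φ ω i)

  φ-cong : ∀ ω ω′ → ω ≈ᶜ ω′ → φ ω ≈ₚ φ ω′
  φ-cong ω ω′ ω≈ω′ = code-injective (φ ω) (φ ω′) λ i →
    trans (code-φ ω i) (trans (codeOf-cong {ω} {ω′} ω≈ω′ i) (sym (code-φ ω′ i)))

  φ-injective : ∀ ω ω′ → φ ω ≈ₚ φ ω′ → ω ≈ᶜ ω′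
  φ-injective ω ω′ φω≈φω′ = codeOf-injective ω ω′ λ i →
    trans (sym (code-φ ω i)) (trans (code-cong (φ ω) (φ ω′) φω≈φω′ i) (code-φ ω′ i))

  φ-antitone : ∀ ω → Antitone (code (φ ω))
  φ-antitone ω i j i<j = subst₂ _≤_ (sym (code-φ ω j)) (sym (code-φ ω i)) (codeOf-antitone ω i j i<j)

  φ-avoids132 : ∀ ω → Avoids132 (φ ω)
  φ-avoids132 ω = antitone⇒avoids132 (φ ω) (φ-antitone ω)

  φ-surjective : ∀ σ → Avoids132 σ → Σ (Cover N) λ ω → φ ω ≈ₚ σ
  φ-surjective σ avoids = ω , code-injective (φ ω) σ λ i →
    trans (code-φ ω i) (codeOf-coverOf (code σ) anti (code-bounded σ) i)
    where
    anti : Antitone (code σ)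
    anti = avoids132⇒antitone σ avoids
    ω : Cover N
    ω = coverOf (code σ) anti (code-bounded σ)

  inv-φ : ∀ ω → inv (φ ω) ≡ sum (codeOf n ω)
  inv-φ ω = trans (inv≡sum-code (φ ω)) (sum-cong-≗ (code-φ ω))

module Correspondence {N} (1≤N : 1 ≤ N) (c : Point → Bool)
                      (proper : ProperColouring N c) (normalised : Normalised N c) where

  open CoverCodes 1≤N
  open Bijection 1≤N public
  open TwistOrder 1≤N c proper normalised

  twistOrder⇔bruhat : ∀ ω ω′ → (ω ≤F⟨ c ⟩ ω′) ⇔ (φ ω ≤B φ ω′)
  twistOrder⇔bruhat ω ω′ = mk⇔
    (λ ω≤ω′ → code-≤⇒bruhat (φ ω) (φ ω′) (λ i → subst₂ _≤_ (sym (code-φ ω i)) (sym (code-φ ω′ i))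
                                                  (Equivalence.to (twistOrder⇔codes ω ω′) ω≤ω′ i)))
    (λ φω≤φω′ → Equivalence.from (twistOrder⇔codes ω ω′) (λ i → subst₂ _≤_ (code-φ ω i) (code-φ ω′ i)
                                                              (bruhat⇒code-≤ (φ-antitone ω) φω≤φω′ i)))

  rank-count : ∀ k → Σ ℕ λ m → HasCount (Cover N) _≈ᶜ_ (λ ω → Rank N c ω k) m ×
                               HasCount (Perm n) _≈ₚ_ (λ σ → Avoids132 σ × inv σ ≡ k) m
  rank-count k with count-132-avoiding n k
  ... | m , perms = m , count-pullback ≈ₚ-isEquivalence φ (φ-cong _ _) (φ-injective _ _) rank⇒avoiding avoiding⇒rank perms ,
                      perms
    where
    rank⇒avoiding : ∀ ω → Rank N c ω k → Avoids132 (φ ω) × inv (φ ω) ≡ k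
    rank⇒avoiding ω rank = φ-avoids132 ω , trans (inv-φ ω) (Equivalence.to (rank⇔sum ω k) rank)
    avoiding⇒rank : ∀ σ → Avoids132 σ × inv σ ≡ k → Σ (Cover N) λ ω → Rank N c ω k × φ ω ≈ₚ σ
    avoiding⇒rank σ (avoids , inv≡k) with φ-surjective σ avoids
    ... | ω , φω≈σ =
      ω , Equivalence.from (rank⇔sum ω k) (trans (sym (inv-φ ω)) (trans (inv-resp (φ ω) σ φω≈σ) inv≡k)) , φω≈σ

theorem10 : (n : ℕ) → 2 ≤ n →
    (c : Point → Bool) → ProperColouring (n ∸ 1) c → Normalised (n ∸ 1) c →
    (Σ (Cover (n ∸ 1) → Perm n) λ φ →
      (∀ ω i → lehmer (φ ω) i ≡ codeOf n ω i) ×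
      (∀ ω ω' → ω ≈ᶜ ω' → φ ω ≈ₚ φ ω') ×
      (∀ ω → Avoids132 (φ ω)) ×
      (∀ ω ω' → φ ω ≈ₚ φ ω' → ω ≈ᶜ ω') ×
      (∀ σ → Avoids132 σ → Σ (Cover (n ∸ 1)) λ ω → φ ω ≈ₚ σ) ×
      (∀ ω ω' → (ω ≤F⟨ c ⟩ ω') ⇔ (φ ω ≤B φ ω')))
    ×
    (∀ k → Σ ℕ λ m →
      HasCount (Cover (n ∸ 1)) _≈ᶜ_ (λ ω → Rank (n ∸ 1) c ω k) m ×
      HasCount (Perm n) _≈ₚ_ (λ σ → Avoids132 σ × inv σ ≡ k) m)
theorem10 (suc (suc N)) (s≤s (s≤s z≤n)) c proper normalised =
  (φ , lehmer-φ , φ-cong , φ-avoids132 , φ-injective , φ-surjective , twistOrder⇔bruhat) , rank-count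
  where open Correspondence (s≤s (z≤n {N})) c proper normalised
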